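{- Let $p\ge5$ be a prime, $d\ge1$, $n=d(p-1)$, and let $\delta=0$ if $d\ge2$ and $d\equiv1\pmod p$, and $\delta=1$ otherwise (in particular $\delta=1$ if $d\le p$). For $r\ge1$ and $p\ge\max(5,r+3-\delta)$, \[ \widehat{S}_n(p)\equiv \widetilde{B}_n + \sum_{\substack{\nu=2\\ \nu\text{ even}}}^{r-1}\binom{n}{\nu+1}\widetilde{B}^{*}_{n-\nu}\,p^\nu \pmod{p^r}. \] In particular, if $d\le p$: $\widehat{S}_n(p)\equiv\widetilde{B}_n\pmod{p}$ and $\pmod{p^2}$ for $p\ge5$; $\widehat{S}_n(p)\equiv\widetilde{B}_n+p^2\binom n3\widetilde{B}^{*}_{n-2}\pmod{p^3}$ for $p\ge5$; $\widehat{S}_n(p)\equiv\widetilde{B}_n+p^2\binom n3\widetilde{B}^{*}_{n-2}\pmod{p^4}$ for $p\ge7$; $\widehat{S}_n(p)\equiv\widetilde{B}_n+p^2\binom n3\widetilde{B}^{*}_{n-2}+p^4\binom n5\widetilde{B}^{*}_{n-4}\pmod{p^5}$ for $p\ge7$; $\widehat{S}_n(p)\equiv\widetilde{B}_n+p^2\binom n3\widetilde{B}^{*}_{n-2}+p^4\binom n5\widetilde{B}^{*}_{n-4}\pmod{p^6}$ for $p\ge11$.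
   Context: The Bernoulli numbers $B_n$ are defined by $\frac{t}{e^t-1}=\sum_{n\ge0}B_n\frac{t^n}{n!}$. For an odd prime $p$ and even $n\ge0$: $\widetilde{B}_0=0$, $\widetilde{B}_n=B_n+\frac1p-1$ if $n>0$ and $p-1\mid n$, $\widetilde{B}_n=B_n$ otherwise; $\widetilde{B}^{*}_n=\widetilde{B}_n/n$ for $n>0$. Power sums $S_n(m)=\sum_{\nu=1}^{m-1}\nu^n$ for $n\ge1$ (a polynomial in $m$), $S_0(m)=m-1$, and $\widehat{S}_n(x)=\frac{S_n(x)-S_0(x)}{x}$. Congruences mod $p^r$ between $p$-integral rationals mean the difference lies in $p^r\mathbb{Z}_p$. -}

module Defs where

open import Data.Nat as ℕ using (ℕ; zero; suc; _∸_; _^_; _≤?_)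
open import Data.Nat.Divisibility using (_∣_; _∣?_)
open import Data.Nat.Combinatorics using (_C_)
open import Data.Integer as ℤ using (ℤ; +_)
open import Data.Rational using (ℚ; 0ℚ; 1ℚ; _+_; _-_; _*_; -_; _/_; ↥_; ↧ₙ_)
open import Data.List using (List; []; _∷_; _++_)
open import Data.Bool using (Bool; true; false; if_then_else_; _∧_)
open import Data.Product using (_×_)
open import Relation.Nullary using (¬_; does)

toℚ : ℕ → ℚ
toℚ k = (+ k) / 1

-- 1/k as a rational (only used for k ≠ 0; convention 1/0 := 0)
inv : ℕ → ℚ
inv zero = 0ℚ
inv (suc k) = (+ 1) / suc k

Σℚ : ℕ → (ℕ → ℚ) → ℚ
Σℚ zero f = 0ℚ
Σℚ (suc n) f = Σℚ n f + f n

Σℕ : ℕ → (ℕ → ℕ) → ℕ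
Σℕ zero f = 0
Σℕ (suc n) f = Σℕ n f ℕ.+ f n

nth : List ℚ → ℕ → ℚ
nth [] k = 0ℚ
nth (x ∷ xs) zero = x
nth (x ∷ xs) (suc k) = nth xs k

-- bernList n = [B_0, ..., B_n], via the recurrence
-- B_0 = 1,  B_m = -(1/(m+1)) Σ_{k<m} C(m+1,k) B_k  (m ≥ 1),
-- which is equivalent to t/(e^t - 1) = Σ B_n t^n/n!  (so B_1 = -1/2).
bernList : ℕ → List ℚ
bernList zero = 1ℚ ∷ []
bernList (suc n) =
  bernList n ++ ((- (inv (suc (suc n)) * Σℚ (suc n) (λ k → toℚ (suc (suc n) C k) * nth (bernList n) k))) ∷ [])

B : ℕ → ℚ
B n = nth (bernList n) n

Bt : ℕ → ℕ → ℚ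
Bt p zero = 0ℚ
Bt p (suc m) = if does ((p ∸ 1) ∣? suc m) then B (suc m) + inv p - 1ℚ else B (suc m)

-- B~*_n = B~_n / n  (n > 0; value at 0 is irrelevant, set to 0)
Bstar : ℕ → ℕ → ℚ
Bstar p n = Bt p n * inv n

-- power sums S_n(m) = Σ_{ν=1}^{m-1} ν^n (n ≥ 1),  S_0(m) = m - 1
S : ℕ → ℕ → ℕ
S zero m = m ∸ 1
S (suc n) m = Σℕ m (λ ν → ν ^ suc n)

Shat : ℕ → ℕ → ℚ
Shat n x = (toℚ (S n x) - toℚ (S 0 x)) * inv x

delta : ℕ → ℕ → ℕ
delta d p = if does (2 ≤? d) ∧ does (p ∣? (d ∸ 1)) then 0 else 1

-- x ≡ y (mod p^r) for rationals: x - y ∈ p^r ℤ_p, i.e. (in lowest terms)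
-- p^r divides the numerator and p does not divide the denominator of x - y
CongMod : ℕ → ℕ → ℚ → ℚ → Set
CongMod p r x y = ((p ^ r) ∣ ℤ.∣ ↥ (x - y) ∣) × (¬ (p ∣ ↧ₙ (x - y)))

isEven : ℕ → Bool
isEven ν = does (2 ∣? ν)

corrSum : ℕ → ℕ → ℕ → ℚ
corrSum p n r =
  Σℚ r (λ ν → if isEven ν ∧ does (2 ≤? ν)
                then toℚ (n C (suc ν)) * Bstar p (n ∸ ν) * toℚ (p ^ ν)
                else 0ℚ)

-- Faulhaber's formula, written in terms of ν = n − k, gives
--   Ŝ_n(p) = B_n − (p − 1)/p + Σ_{ν=1}^{n} C(n, ν) B_{n−ν} p^ν / (ν + 1).
-- Since (p − 1) ∣ n, the constant is absorbed by B̃_n = B_n + 1/p − 1, and it remains to see that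
-- the ν-th term equals the ν-th correction term for ν < r and is divisible by p^r for ν ≥ r.
-- For 0 < ν < r, (p − 1) ∤ n − ν so B̃_{n−ν} = B_{n−ν}; for odd ν this is an odd-index Bernoulli
-- number and vanishes, for even ν one uses C(n, ν)/(ν + 1) = C(n, ν + 1)/(n − ν).
-- For ν ≥ r it suffices that p B_m is p-integral, and B_m too when (p − 1) ∤ m. This weak
-- von Staudt–Clausen theorem follows from p B_m ≡ S_m(p) (mod p), again by Faulhaber, and from
-- S_m(p) ≡ 0 (mod p) for (p − 1) ∤ m, by Σ_{j≤k} C(k + 1, j) S_j(p) = p^{k+1} and Fermat.
-- The one term that can fail, ν = p − 1 with p ∤ C(n, p − 1), forces p ∣ d − 1: this is δ.

module Submission where

open import Algebra.Bundles using (CommutativeRing)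
open import Data.Bool using (true; false; if_then_else_; _∧_)
open import Data.Bool.Properties using (if-cong)
open import Data.Empty using (⊥-elim)
open import Data.Integer as ℤ using (ℤ)
import Data.Integer.Properties as ℤ
open import Data.List using ([]; _∷_; _++_; length)
open import Data.List.Properties using (length-++)
open import Data.Nat as ℕ using (ℕ; zero; suc; pred; _+_; _*_; _∸_; _^_; _≤_; _<_; z≤n; s≤s; _!; _≤?_)
import Data.Nat.Properties as ℕ
import Data.Nat.DivMod as ℕ
open import Data.Nat.Combinatorics
  using (_C_; nCn≡1; nC1≡n; nCk≡nC[n∸k]; k>n⇒nCk≡0; nCk≡n!/k![n-k]!; k![n∸k]!∣n!; nCk+nC[k+1]≡[n+1]C[k+1])
open import Data.Nat.Coprimality using (1-coprimeTo; recompute)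
open import Data.Nat.Divisibility
open import Data.Nat.Induction using (<-rec)
open import Data.Nat.Primality using (Prime; euclidsLemma; prime⇒nonZero; composite; ¬prime[0]; ¬prime[1]; prime⇒nonTrivial)
open import Data.Nat.Solver renaming (module +-*-Solver to ℕ-Solver)
open import Data.Product using (∃; ∃₂; _×_; _,_)
open import Data.Rational as ℚ using (ℚ; mkℚ; 0ℚ; 1ℚ; _/_; ↥_; ↧ₙ_; toℚᵘ)
  renaming (_+_ to _+ℚ_; _*_ to _*ℚ_; _-_ to _-ℚ_; -_ to -ℚ_)
import Data.Rational.Properties as ℚ
open import Algebra.Properties.CommutativeSemiring.Exp (CommutativeRing.commutativeSemiring ℚ.+-*-commutativeRing)
  using (^-homo-*; ^-distrib-*) renaming (_^_ to _^ℚ_)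
open import Data.Rational.Solver renaming (module +-*-Solver to ℚ-Solver)
open import Data.Rational.Unnormalised as ℚᵘ using (mkℚᵘ; *≡*)
import Data.Rational.Unnormalised.Properties as ℚᵘ
open import Data.Sum using (_⊎_; inj₁; inj₂)
open import Function using (_∘_)
open import Relation.Binary.PropositionalEquality
open import Relation.Nullary using (¬_; Dec; yes; no; does)
open import Relation.Nullary.Decidable using (dec-true; dec-false)

open import Defs

-- Binomial coefficients

nCk*k!*[n∸k]!≡n! : ∀ {n k} → k ≤ n → (n C k) * (k ! * (n ∸ k) !) ≡ n !
nCk*k!*[n∸k]!≡n! {n} {k} k≤n =
  trans (cong (_* (k ! * (n ∸ k) !)) (nCk≡n!/k![n-k]! k≤n)) (ℕ.m/n*n≡m {{k ℕ.!* (n ∸ k) !≢0}} (k![n∸k]!∣n! k≤n))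

[n+1]Cn≡n+1 : ∀ n → suc n C n ≡ suc n
[n+1]Cn≡n+1 n = trans (nCk≡nC[n∸k] (ℕ.n≤1+n n)) (trans (cong (suc n C_) (ℕ.m+n∸n≡m 1 n)) (nC1≡n (suc n)))

[k+1]*[n+1]C[k+1]≡[n+1]*nCk : ∀ n k → suc k * (suc n C suc k) ≡ suc n * (n C k)
[k+1]*[n+1]C[k+1]≡[n+1]*nCk n k with k ℕ.≤? n
... | no k≰n = begin
  suc k * (suc n C suc k) ≡⟨ cong (suc k *_) (k>n⇒nCk≡0 (s≤s (ℕ.≰⇒> k≰n))) ⟩
  suc k * 0               ≡⟨ ℕ.*-zeroʳ (suc k) ⟩
  0                       ≡⟨ ℕ.*-zeroʳ (suc n) ⟨
  suc n * 0               ≡⟨ cong (suc n *_) (k>n⇒nCk≡0 (ℕ.≰⇒> k≰n)) ⟨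
  suc n * (n C k)         ∎
  where
  open ≡-Reasoning
... | yes k≤n = ℕ.*-cancelʳ-≡ _ _ (k ! * (n ∸ k) !) {{k ℕ.!* (n ∸ k) !≢0}} (begin
  suc k * (suc n C suc k) * (k ! * (n ∸ k) !)
    ≡⟨ solve 4 (λ a b c d → a :* b :* (c :* d) := b :* ((a :* c) :* d)) refl (suc k) (suc n C suc k) (k !) ((n ∸ k) !) ⟩
  (suc n C suc k) * (suc k ! * (suc n ∸ suc k) !)   ≡⟨ nCk*k!*[n∸k]!≡n! (s≤s k≤n) ⟩
  suc n !                                           ≡⟨ cong (suc n *_) (nCk*k!*[n∸k]!≡n! k≤n) ⟨
  suc n * ((n C k) * (k ! * (n ∸ k) !))             ≡⟨ ℕ.*-assoc (suc n) (n C k) _ ⟨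
  suc n * (n C k) * (k ! * (n ∸ k) !)               ∎)
  where
  open ≡-Reasoning
  open ℕ-Solver

[k+1]*nC[k+1]≡[n∸k]*nCk : ∀ n k → suc k * (n C suc k) ≡ (n ∸ k) * (n C k)
[k+1]*nC[k+1]≡[n∸k]*nCk n k = ℕ.+-cancelˡ-≡ (suc k * (n C k)) _ _ (begin
  suc k * (n C k) + suc k * (n C suc k)  ≡⟨ ℕ.*-distribˡ-+ (suc k) (n C k) (n C suc k) ⟨
  suc k * (n C k + n C suc k)            ≡⟨ cong (suc k *_) (nCk+nC[k+1]≡[n+1]C[k+1] n k) ⟩
  suc k * (suc n C suc k)                ≡⟨ [k+1]*[n+1]C[k+1]≡[n+1]*nCk n k ⟩
  suc n * (n C k)                        ≡⟨ split (k ℕ.≤? n) ⟩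
  suc k * (n C k) + (n ∸ k) * (n C k)    ∎)
  where
  open ≡-Reasoning
  split : Dec (k ≤ n) → suc n * (n C k) ≡ suc k * (n C k) + (n ∸ k) * (n C k)
  split (yes k≤n) = trans (cong (λ m → suc m * (n C k)) (sym (ℕ.m+[n∸m]≡n k≤n)))
                          (ℕ.*-distribʳ-+ (n C k) (suc k) (n ∸ k))
  split (no k≰n) rewrite k>n⇒nCk≡0 {n} {k} (ℕ.≰⇒> k≰n) =
    trans (ℕ.*-zeroʳ (suc n)) (sym (cong₂ _+_ (ℕ.*-zeroʳ (suc k)) (ℕ.*-zeroʳ (n ∸ k))))

private
  nCk*[n∸k]Ci*k!*i!*[n∸[k+i]]!≡n! : ∀ n k i → k + i ≤ n →
    (n C k) * ((n ∸ k) C i) * (k ! * (i ! * (n ∸ (k + i)) !)) ≡ n !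
  nCk*[n∸k]Ci*k!*i!*[n∸[k+i]]!≡n! n k i k+i≤n = begin
    (n C k) * ((n ∸ k) C i) * (k ! * (i ! * (n ∸ (k + i)) !))
      ≡⟨ cong (λ m → (n C k) * ((n ∸ k) C i) * (k ! * (i ! * m !))) (sym (ℕ.∸-+-assoc n k i)) ⟩
    (n C k) * ((n ∸ k) C i) * (k ! * (i ! * (n ∸ k ∸ i) !))
      ≡⟨ solve 5 (λ a b c d e → a :* b :* (c :* (d :* e)) := a :* (c :* (b :* (d :* e)))) refl
           (n C k) ((n ∸ k) C i) (k !) (i !) ((n ∸ k ∸ i) !) ⟩
    (n C k) * (k ! * (((n ∸ k) C i) * (i ! * (n ∸ k ∸ i) !)))
      ≡⟨ cong (λ m → (n C k) * (k ! * m)) (nCk*k!*[n∸k]!≡n! (ℕ.m+n≤o⇒m≤o∸n i (subst (_≤ n) (ℕ.+-comm k i) k+i≤n))) ⟩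
    (n C k) * (k ! * (n ∸ k) !)
      ≡⟨ nCk*k!*[n∸k]!≡n! (ℕ.m+n≤o⇒m≤o k k+i≤n) ⟩
    n ! ∎
    where
    open ≡-Reasoning
    open ℕ-Solver

nCk*[n∸k]Ci≡nCi*[n∸i]Ck : ∀ n k i → k + i ≤ n → (n C k) * ((n ∸ k) C i) ≡ (n C i) * ((n ∸ i) C k)
nCk*[n∸k]Ci≡nCi*[n∸i]Ck n k i k+i≤n = ℕ.*-cancelʳ-≡ _ _ (k ! * (i ! * M !)) {{k!i!M!≢0}} (begin
  (n C k) * ((n ∸ k) C i) * (k ! * (i ! * M !))  ≡⟨ nCk*[n∸k]Ci*k!*i!*[n∸[k+i]]!≡n! n k i k+i≤n ⟩
  n !                                             ≡⟨ nCk*[n∸k]Ci*k!*i!*[n∸[k+i]]!≡n! n i k i+k≤n ⟨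
  (n C i) * ((n ∸ i) C k) * (i ! * (k ! * (n ∸ (i + k)) !))
    ≡⟨ cong (λ m → (n C i) * ((n ∸ i) C k) * (i ! * (k ! * (n ∸ m) !))) (ℕ.+-comm i k) ⟩
  (n C i) * ((n ∸ i) C k) * (i ! * (k ! * M !))
    ≡⟨ cong ((n C i) * ((n ∸ i) C k) *_) (solve 3 (λ a b c → a :* (b :* c) := b :* (a :* c)) refl (i !) (k !) (M !)) ⟩
  (n C i) * ((n ∸ i) C k) * (k ! * (i ! * M !))  ∎)
  where
  open ≡-Reasoning
  open ℕ-Solver
  M = n ∸ (k + i)
  i+k≤n : i + k ≤ n
  i+k≤n = subst (_≤ n) (ℕ.+-comm k i) k+i≤n
  k!i!M!≢0 : ℕ.NonZero (k ! * (i ! * M !))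
  k!i!M!≢0 = ℕ.m*n≢0 (k !) _ {{k ℕ.!≢0}} {{i ℕ.!* M !≢0}}

-- Applied with p ^ e ∣ ν + 1: then p ^ ν / (ν + 1), of valuation ν − e, is divisible by p ^ r.

module _ {p : ℕ} (3≤p : 3 ≤ p) where

  p+2e≤p^[1+e] : ∀ e → p + 2 * e ≤ p ^ suc e
  p+2e≤p^[1+e] zero = ℕ.≤-reflexive (trans (ℕ.+-identityʳ p) (sym (ℕ.*-identityʳ p)))
  p+2e≤p^[1+e] (suc e) = begin
    p + 2 * suc e  ≡⟨ solve 2 (λ p e → p :+ con 2 :* (con 1 :+ e) := (p :+ con 2 :* e) :+ con 2) refl p e ⟩
    x + 2          ≤⟨ ℕ.+-monoʳ-≤ x (ℕ.≤-trans 2≤x (ℕ.m≤m+n x (x + 0))) ⟩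
    3 * x          ≤⟨ ℕ.*-mono-≤ 3≤p (p+2e≤p^[1+e] e) ⟩
    p ^ suc (suc e) ∎
    where
    open ℕ.≤-Reasoning
    open ℕ-Solver
    x = p + 2 * e
    2≤x : 2 ≤ x
    2≤x = ℕ.≤-trans (ℕ.≤-trans (s≤s (s≤s z≤n)) 3≤p) (ℕ.m≤m+n p (2 * e))

  r+e≤ν : ∀ {r ν} e → r + 2 ≤ p → r ≤ ν → p ^ e ≤ suc ν → r + e ≤ ν
  r+e≤ν {r} zero _ r≤ν _ = subst (_≤ _) (sym (ℕ.+-identityʳ r)) r≤ν
  r+e≤ν {r} {ν} (suc e) r+2≤p _ pᵉ≤ = ℕ.≤-pred (begin
    suc (r + suc e)  ≡⟨ solve 2 (λ r e → con 1 :+ (r :+ (con 1 :+ e)) := (r :+ con 2) :+ e) refl r e ⟩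
    (r + 2) + e      ≤⟨ ℕ.+-mono-≤ r+2≤p (ℕ.m≤m+n e (e + 0)) ⟩
    p + 2 * e        ≤⟨ p+2e≤p^[1+e] e ⟩
    p ^ suc e        ≤⟨ pᵉ≤ ⟩
    suc ν            ∎)
    where
    open ℕ.≤-Reasoning
    open ℕ-Solver

  r+e≤ν-for-large-ν : ∀ {r ν} e → r + 2 ≤ p → p ≤ ν → p ^ e ≤ suc (suc ν) → r + e ≤ ν
  r+e≤ν-for-large-ν {r} zero r+2≤p p≤ν _ =
    ℕ.≤-trans (ℕ.≤-reflexive (ℕ.+-identityʳ r)) (ℕ.≤-trans (ℕ.m+n≤o⇒m≤o r r+2≤p) p≤ν)
  r+e≤ν-for-large-ν {r} (suc zero) r+2≤p p≤ν _ =
    ℕ.≤-trans (ℕ.+-monoʳ-≤ r (s≤s z≤n)) (ℕ.≤-trans r+2≤p p≤ν)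
  r+e≤ν-for-large-ν {r} {ν} (suc (suc e)) r+2≤p _ pᵉ≤ = ℕ.≤-pred (ℕ.≤-pred (begin
    suc (suc (r + suc (suc e)))  ≡⟨ solve 2 (λ r e → con 2 :+ (r :+ (con 2 :+ e)) := (r :+ con 2) :+ (con 2 :+ e)) refl r e ⟩
    (r + 2) + (2 + e)            ≤⟨ ℕ.+-mono-≤ r+2≤p (ℕ.+-monoʳ-≤ 2 (ℕ.m≤m+n e (e + 0))) ⟩
    p + (2 + 2 * e)              ≡⟨ cong (λ m → p + m) (solve 1 (λ e → con 2 :+ con 2 :* e := con 2 :* (con 1 :+ e)) refl e) ⟩
    p + 2 * suc e                ≤⟨ p+2e≤p^[1+e] (suc e) ⟩
    p ^ suc (suc e)              ≤⟨ pᵉ≤ ⟩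
    suc (suc ν)                  ∎))
    where
    open ℕ.≤-Reasoning
    open ℕ-Solver

[p∸1]+[p∸1]≤1+ν⇒p≤ν : ∀ {p ν} → 3 ≤ p → (p ∸ 1) + (p ∸ 1) ≤ suc ν → p ≤ ν
[p∸1]+[p∸1]≤1+ν⇒p≤ν {suc (suc (suc p))} (s≤s (s≤s (s≤s _))) 2[p∸1]≤1+ν =
  ℕ.≤-pred (ℕ.≤-trans (s≤s (s≤s (ℕ.m≤n+m (suc (suc p)) p))) 2[p∸1]≤1+ν)

m∣n⇒n≡m⊎m+m≤n : ∀ {m n} → 0 < n → m ∣ n → n ≡ m ⊎ m + m ≤ n
m∣n⇒n≡m⊎m+m≤n {m} 0<n (divides zero refl) = ⊥-elim (ℕ.<-irrefl refl 0<n)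
m∣n⇒n≡m⊎m+m≤n {m} _ (divides (suc zero) refl) = inj₁ (ℕ.+-identityʳ m)
m∣n⇒n≡m⊎m+m≤n {m} _ (divides (suc (suc q)) refl) = inj₂ (ℕ.+-monoʳ-≤ m (ℕ.m≤m+n m (q * m)))

open ℚ-Solver

fromℤ : ℤ → ℚ
fromℤ i = i / 1

private
  toℚᵘ-fromℤ : ∀ i → toℚᵘ (fromℤ i) ℚᵘ.≃ mkℚᵘ i 0
  toℚᵘ-fromℤ i = ℚ.toℚᵘ-fromℚᵘ (mkℚᵘ i 0)

fromℤ-+ : ∀ a b → fromℤ (a ℤ.+ b) ≡ fromℤ a +ℚ fromℤ b
fromℤ-+ a b = ℚ.toℚᵘ-injective (begin
  toℚᵘ (fromℤ (a ℤ.+ b))              ≈⟨ toℚᵘ-fromℤ (a ℤ.+ b) ⟩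
  mkℚᵘ (a ℤ.+ b) 0                    ≈⟨ *≡* (cong (ℤ._* ℤ.+ 1) (sym (cong₂ ℤ._+_ (ℤ.*-identityʳ a) (ℤ.*-identityʳ b)))) ⟩
  mkℚᵘ a 0 ℚᵘ.+ mkℚᵘ b 0              ≈⟨ ℚᵘ.+-cong (toℚᵘ-fromℤ a) (toℚᵘ-fromℤ b) ⟨
  toℚᵘ (fromℤ a) ℚᵘ.+ toℚᵘ (fromℤ b)  ≈⟨ ℚ.toℚᵘ-homo-+ (fromℤ a) (fromℤ b) ⟨
  toℚᵘ (fromℤ a +ℚ fromℤ b)           ∎)
  where
  open ℚᵘ.≃-Reasoning

fromℤ-* : ∀ a b → fromℤ (a ℤ.* b) ≡ fromℤ a *ℚ fromℤ b
fromℤ-* a b = ℚ.toℚᵘ-injective (begin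
  toℚᵘ (fromℤ (a ℤ.* b))              ≈⟨ toℚᵘ-fromℤ (a ℤ.* b) ⟩
  mkℚᵘ a 0 ℚᵘ.* mkℚᵘ b 0              ≈⟨ ℚᵘ.*-cong (toℚᵘ-fromℤ a) (toℚᵘ-fromℤ b) ⟨
  toℚᵘ (fromℤ a) ℚᵘ.* toℚᵘ (fromℤ b)  ≈⟨ ℚ.toℚᵘ-homo-* (fromℤ a) (fromℤ b) ⟨
  toℚᵘ (fromℤ a *ℚ fromℤ b)           ∎)
  where
  open ℚᵘ.≃-Reasoning

fromℤ-neg : ∀ a → fromℤ (ℤ.- a) ≡ -ℚ fromℤ a
fromℤ-neg a = ℚ.toℚᵘ-injective (begin
  toℚᵘ (fromℤ (ℤ.- a))        ≈⟨ toℚᵘ-fromℤ (ℤ.- a) ⟩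
  ℚᵘ.- mkℚᵘ a 0              ≈⟨ ℚᵘ.-‿cong (toℚᵘ-fromℤ a) ⟨
  ℚᵘ.- toℚᵘ (fromℤ a)        ≈⟨ ℚ.toℚᵘ-homo‿- (fromℤ a) ⟨
  toℚᵘ (-ℚ fromℤ a)          ∎)
  where
  open ℚᵘ.≃-Reasoning

toℚ-+ : ∀ a b → toℚ (a + b) ≡ toℚ a +ℚ toℚ b
toℚ-+ a b = fromℤ-+ (ℤ.+ a) (ℤ.+ b)

toℚ-* : ∀ a b → toℚ (a * b) ≡ toℚ a *ℚ toℚ b
toℚ-* a b = trans (cong fromℤ (ℤ.pos-* a b)) (fromℤ-* (ℤ.+ a) (ℤ.+ b))

toℚ-suc : ∀ n → toℚ (suc n) ≡ toℚ n +ℚ 1ℚ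
toℚ-suc n = trans (cong toℚ (ℕ.+-comm 1 n)) (toℚ-+ n 1)

toℚ-^ : ∀ m k → toℚ (m ^ k) ≡ toℚ m ^ℚ k
toℚ-^ m zero    = refl
toℚ-^ m (suc k) = trans (toℚ-* m (m ^ k)) (cong (toℚ m *ℚ_) (toℚ-^ m k))

toℚ*inv≡1 : ∀ k → toℚ (suc k) *ℚ inv (suc k) ≡ 1ℚ
toℚ*inv≡1 k = ℚ.toℚᵘ-injective (begin
  toℚᵘ (toℚ (suc k) *ℚ inv (suc k))           ≈⟨ ℚ.toℚᵘ-homo-* (toℚ (suc k)) (inv (suc k)) ⟩
  toℚᵘ (toℚ (suc k)) ℚᵘ.* toℚᵘ (inv (suc k))
    ≈⟨ ℚᵘ.*-cong (toℚᵘ-fromℤ (ℤ.+ suc k)) (ℚᵘ.≃-reflexive (cong toℚᵘ (ℚ.normalize-coprime (1-coprimeTo (suc k))))) ⟩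
  mkℚᵘ (ℤ.+ suc k) 0 ℚᵘ.* mkℚᵘ (ℤ.+ 1) k
    ≈⟨ *≡* (cong ℤ.+_ (trans (ℕ.*-identityʳ _) (trans (ℕ.*-identityʳ _) (sym (trans (ℕ.+-identityʳ _) (ℕ.*-identityˡ _)))))) ⟩
  toℚᵘ 1ℚ                                     ∎)
  where
  open ℚᵘ.≃-Reasoning

*-cancelˡ-toℚ : ∀ k {x y} → toℚ (suc k) *ℚ x ≡ toℚ (suc k) *ℚ y → x ≡ y
*-cancelˡ-toℚ k {x} {y} eq = begin
  x                                    ≡⟨ ℚ.*-identityʳ x ⟨
  x *ℚ 1ℚ                              ≡⟨ cong (x *ℚ_) (toℚ*inv≡1 k) ⟨
  x *ℚ (toℚ (suc k) *ℚ inv (suc k))    ≡⟨ solve 3 (λ x n i → x :* (n :* i) := (n :* x) :* i) refl x (toℚ (suc k)) (inv (suc k)) ⟩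
  (toℚ (suc k) *ℚ x) *ℚ inv (suc k)    ≡⟨ cong (_*ℚ inv (suc k)) eq ⟩
  (toℚ (suc k) *ℚ y) *ℚ inv (suc k)    ≡⟨ solve 3 (λ y n i → (n :* y) :* i := y :* (n :* i)) refl y (toℚ (suc k)) (inv (suc k)) ⟩
  y *ℚ (toℚ (suc k) *ℚ inv (suc k))    ≡⟨ cong (y *ℚ_) (toℚ*inv≡1 k) ⟩
  y *ℚ 1ℚ                              ≡⟨ ℚ.*-identityʳ y ⟩
  y                                    ∎
  where
  open ≡-Reasoning

-- Finite sums

Σℚ-cong : ∀ n {f g : ℕ → ℚ} → (∀ k → k < n → f k ≡ g k) → Σℚ n f ≡ Σℚ n g
Σℚ-cong zero    eq = refl
Σℚ-cong (suc n) eq = cong₂ _+ℚ_ (Σℚ-cong n (λ k k<n → eq k (ℕ.m<n⇒m<1+n k<n))) (eq n ℕ.≤-refl)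

Σℚ-zero : ∀ n → Σℚ n (λ _ → 0ℚ) ≡ 0ℚ
Σℚ-zero zero    = refl
Σℚ-zero (suc n) = cong (_+ℚ 0ℚ) (Σℚ-zero n)

Σℚ-+ : ∀ n (f g : ℕ → ℚ) → Σℚ n (λ k → f k +ℚ g k) ≡ Σℚ n f +ℚ Σℚ n g
Σℚ-+ zero    f g = refl
Σℚ-+ (suc n) f g = trans (cong (_+ℚ (f n +ℚ g n)) (Σℚ-+ n f g))
  (solve 4 (λ a b c d → (a :+ b) :+ (c :+ d) := (a :+ c) :+ (b :+ d)) refl (Σℚ n f) (Σℚ n g) (f n) (g n))

*-distribˡ-Σℚ : ∀ n c (f : ℕ → ℚ) → c *ℚ Σℚ n f ≡ Σℚ n (λ k → c *ℚ f k)
*-distribˡ-Σℚ zero    c f = ℚ.*-zeroʳ c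
*-distribˡ-Σℚ (suc n) c f = trans (ℚ.*-distribˡ-+ c (Σℚ n f) (f n)) (cong (_+ℚ (c *ℚ f n)) (*-distribˡ-Σℚ n c f))

Σℚ-sub : ∀ n (f g : ℕ → ℚ) → Σℚ n (λ k → f k -ℚ g k) ≡ Σℚ n f -ℚ Σℚ n g
Σℚ-sub zero    f g = refl
Σℚ-sub (suc n) f g = trans (cong (_+ℚ (f n -ℚ g n)) (Σℚ-sub n f g))
  (solve 4 (λ a b c d → (a :- b) :+ (c :- d) := (a :+ c) :- (b :+ d)) refl (Σℚ n f) (Σℚ n g) (f n) (g n))

Σℚ-split : ∀ m n (f : ℕ → ℚ) → Σℚ (m + n) f ≡ Σℚ m f +ℚ Σℚ n (λ k → f (m + k))
Σℚ-split m zero    f = trans (cong (λ l → Σℚ l f) (ℕ.+-identityʳ m)) (sym (ℚ.+-identityʳ _))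
Σℚ-split m (suc n) f = begin
  Σℚ (m + suc n) f                                 ≡⟨ cong (λ l → Σℚ l f) (ℕ.+-suc m n) ⟩
  Σℚ (m + n) f +ℚ f (m + n)                        ≡⟨ cong (_+ℚ f (m + n)) (Σℚ-split m n f) ⟩
  (Σℚ m f +ℚ Σℚ n (λ k → f (m + k))) +ℚ f (m + n)  ≡⟨ ℚ.+-assoc (Σℚ m f) _ (f (m + n)) ⟩
  Σℚ m f +ℚ Σℚ (suc n) (λ k → f (m + k))           ∎
  where
  open ≡-Reasoning

Σℚ-first : ∀ n (f : ℕ → ℚ) → Σℚ (suc n) f ≡ f 0 +ℚ Σℚ n (λ k → f (suc k))
Σℚ-first n f = trans (Σℚ-split 1 n f) (cong (_+ℚ Σℚ n (λ k → f (suc k))) (ℚ.+-identityˡ (f 0)))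

Σℚ-reverse : ∀ n (f : ℕ → ℚ) → Σℚ n f ≡ Σℚ n (λ k → f (n ∸ suc k))
Σℚ-reverse zero    f = refl
Σℚ-reverse (suc n) f = begin
  Σℚ n f +ℚ f n                          ≡⟨ cong (_+ℚ f n) (Σℚ-reverse n f) ⟩
  Σℚ n (λ k → f (n ∸ suc k)) +ℚ f n      ≡⟨ ℚ.+-comm _ (f n) ⟩
  f n +ℚ Σℚ n (λ k → f (n ∸ suc k))      ≡⟨ Σℚ-first n (λ k → f (suc n ∸ suc k)) ⟨
  Σℚ (suc n) (λ k → f (suc n ∸ suc k))   ∎
  where
  open ≡-Reasoning

Σℚ-single : ∀ n j (f : ℕ → ℚ) → j < n → (∀ k → k < n → k ≢ j → f k ≡ 0ℚ) → Σℚ n f ≡ f j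
Σℚ-single (suc n) j f j<1+n others with j ℕ.≟ n
... | yes refl = trans (cong (_+ℚ f n) (trans (Σℚ-cong n vanish) (Σℚ-zero n))) (ℚ.+-identityˡ (f n))
  where
  vanish : ∀ k → k < n → f k ≡ 0ℚ
  vanish k k<n = others k (ℕ.m<n⇒m<1+n k<n) (λ { refl → ℕ.<-irrefl refl k<n })
... | no j≢n = trans (cong₂ _+ℚ_ (Σℚ-single n j f j<n (λ k k<n → others k (ℕ.m<n⇒m<1+n k<n)))
                                (others n ℕ.≤-refl (j≢n ∘ sym)))
                     (ℚ.+-identityʳ (f j))
  where j<n = ℕ.≤∧≢⇒< (ℕ.≤-pred j<1+n) j≢n

Σℚ-swap : ∀ m n (F : ℕ → ℕ → ℚ) → Σℚ m (λ i → Σℚ n (F i)) ≡ Σℚ n (λ j → Σℚ m (λ i → F i j))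
Σℚ-swap zero    n F = sym (Σℚ-zero n)
Σℚ-swap (suc m) n F = trans (cong (_+ℚ Σℚ n (F m)) (Σℚ-swap m n F)) (sym (Σℚ-+ n _ (F m)))

Σℚ-triangle-swap : ∀ m (F : ℕ → ℕ → ℚ) →
  Σℚ m (λ k → Σℚ (m ∸ k) (F k)) ≡ Σℚ m (λ i → Σℚ (m ∸ i) (λ k → F k i))
Σℚ-triangle-swap zero    F = refl
Σℚ-triangle-swap (suc m) F = begin
  Σℚ (suc m) (λ k → Σℚ (suc m ∸ k) (F k))                ≡⟨ Σℚ-first m _ ⟩
  Σℚ (suc m) (F 0) +ℚ Σℚ m (λ k → Σℚ (m ∸ k) (F (suc k))) ≡⟨ cong (Σℚ (suc m) (F 0) +ℚ_) (Σℚ-triangle-swap m (F ∘ suc)) ⟩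
  Σℚ (suc m) (F 0) +ℚ Σℚ m G
    ≡⟨ cong (Σℚ (suc m) (F 0) +ℚ_) (sym (trans (cong (Σℚ m G +ℚ_) Gm≡0) (ℚ.+-identityʳ (Σℚ m G)))) ⟩
  Σℚ (suc m) (F 0) +ℚ Σℚ (suc m) G                       ≡⟨ Σℚ-+ (suc m) (F 0) G ⟨
  Σℚ (suc m) (λ i → F 0 i +ℚ G i)                         ≡⟨ Σℚ-cong (suc m) (λ i i<1+m → sym (peel i i<1+m)) ⟩
  Σℚ (suc m) (λ i → Σℚ (suc m ∸ i) (λ k → F k i))         ∎
  where
  open ≡-Reasoning
  G : ℕ → ℚ
  G i = Σℚ (m ∸ i) (λ k → F (suc k) i)
  Gm≡0 : G m ≡ 0ℚ
  Gm≡0 = cong (λ l → Σℚ l (λ k → F (suc k) m)) (ℕ.n∸n≡0 m)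
  peel : ∀ i → i < suc m → Σℚ (suc m ∸ i) (λ k → F k i) ≡ F 0 i +ℚ G i
  peel i (s≤s i≤m) = trans (cong (λ l → Σℚ l (λ k → F k i)) (ℕ.+-∸-assoc 1 i≤m)) (Σℚ-first (m ∸ i) (λ k → F k i))

Σℚ-telescope : ∀ m (g : ℕ → ℚ) → Σℚ m (λ k → g (suc k) -ℚ g k) ≡ g m -ℚ g 0
Σℚ-telescope zero    g = sym (ℚ.+-inverseʳ (g 0))
Σℚ-telescope (suc m) g = trans (cong (_+ℚ (g (suc m) -ℚ g m)) (Σℚ-telescope m g))
  (solve 3 (λ a b c → (b :- a) :+ (c :- b) := c :- a) refl (g 0) (g m) (g (suc m)))

toℚ-Σℕ : ∀ m (f : ℕ → ℕ) → toℚ (Σℕ m f) ≡ Σℚ m (toℚ ∘ f)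
toℚ-Σℕ zero    f = refl
toℚ-Σℕ (suc m) f = trans (toℚ-+ (Σℕ m f) (f m)) (cong (_+ℚ toℚ (f m)) (toℚ-Σℕ m f))

binomial : ∀ x j → (x +ℚ 1ℚ) ^ℚ j ≡ Σℚ (suc j) (λ i → toℚ (j C i) *ℚ x ^ℚ i)
binomial x zero    = refl
binomial x (suc j) = begin
  (x +ℚ 1ℚ) *ℚ (x +ℚ 1ℚ) ^ℚ j                ≡⟨ cong ((x +ℚ 1ℚ) *ℚ_) (binomial x j) ⟩
  (x +ℚ 1ℚ) *ℚ Σℚ (suc j) t                   ≡⟨ ℚ.*-distribʳ-+ (Σℚ (suc j) t) x 1ℚ ⟩
  x *ℚ Σℚ (suc j) t +ℚ 1ℚ *ℚ Σℚ (suc j) t     ≡⟨ cong₂ _+ℚ_ shifted unshifted ⟩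
  Σℚ (suc j) lower +ℚ (1ℚ +ℚ Σℚ (suc j) upper)
    ≡⟨ solve 2 (λ a b → a :+ (con 1ℚ :+ b) := con 1ℚ :+ (a :+ b)) refl (Σℚ (suc j) lower) (Σℚ (suc j) upper) ⟩
  1ℚ +ℚ (Σℚ (suc j) lower +ℚ Σℚ (suc j) upper) ≡⟨ cong (1ℚ +ℚ_) (Σℚ-+ (suc j) lower upper) ⟨
  1ℚ +ℚ Σℚ (suc j) (λ i → lower i +ℚ upper i)  ≡⟨ cong (1ℚ +ℚ_) (Σℚ-cong (suc j) (λ i _ → pascal i)) ⟩
  1ℚ +ℚ Σℚ (suc j) (λ i → toℚ (suc j C suc i) *ℚ x ^ℚ suc i) ≡⟨ Σℚ-first (suc j) _ ⟨
  Σℚ (suc (suc j)) (λ i → toℚ (suc j C i) *ℚ x ^ℚ i) ∎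
  where
  open ≡-Reasoning
  t lower upper : ℕ → ℚ
  t i     = toℚ (j C i) *ℚ x ^ℚ i
  lower i = toℚ (j C i) *ℚ x ^ℚ suc i
  upper i = toℚ (j C suc i) *ℚ x ^ℚ suc i
  shifted : x *ℚ Σℚ (suc j) t ≡ Σℚ (suc j) lower
  shifted = trans (*-distribˡ-Σℚ (suc j) x t)
    (Σℚ-cong (suc j) (λ i _ → solve 3 (λ x c w → x :* (c :* w) := c :* (x :* w)) refl x (toℚ (j C i)) (x ^ℚ i)))
  upper-j≡0 : upper j ≡ 0ℚ
  upper-j≡0 = trans (cong (λ c → toℚ c *ℚ x ^ℚ suc j) (k>n⇒nCk≡0 (ℕ.n<1+n j))) (ℚ.*-zeroˡ (x ^ℚ suc j))
  unshifted : 1ℚ *ℚ Σℚ (suc j) t ≡ 1ℚ +ℚ Σℚ (suc j) upper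
  unshifted = begin
    1ℚ *ℚ Σℚ (suc j) t               ≡⟨ ℚ.*-identityˡ _ ⟩
    Σℚ (suc j) t                     ≡⟨ Σℚ-first j t ⟩
    1ℚ +ℚ Σℚ j upper
      ≡⟨ cong (1ℚ +ℚ_) (sym (trans (cong (Σℚ j upper +ℚ_) upper-j≡0) (ℚ.+-identityʳ (Σℚ j upper)))) ⟩
    1ℚ +ℚ Σℚ (suc j) upper           ∎
  pascal : ∀ i → lower i +ℚ upper i ≡ toℚ (suc j C suc i) *ℚ x ^ℚ suc i
  pascal i = trans (sym (ℚ.*-distribʳ-+ (x ^ℚ suc i) (toℚ (j C i)) (toℚ (j C suc i))))
    (cong (_*ℚ x ^ℚ suc i) (trans (sym (toℚ-+ (j C i) (j C suc i))) (cong toℚ (nCk+nC[k+1]≡[n+1]C[k+1] j i))))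

-- Bernoulli numbers

private
  nth-++ˡ : ∀ xs ys {k} → k < length xs → nth (xs ++ ys) k ≡ nth xs k
  nth-++ˡ (x ∷ xs) ys {zero}  _         = refl
  nth-++ˡ (x ∷ xs) ys {suc k} (s≤s k<n) = nth-++ˡ xs ys k<n

  nth-++-last : ∀ xs y → nth (xs ++ y ∷ []) (length xs) ≡ y
  nth-++-last []       y = refl
  nth-++-last (x ∷ xs) y = nth-++-last xs y

  length-bernList : ∀ n → length (bernList n) ≡ suc n
  length-bernList zero    = refl
  length-bernList (suc n) = trans (length-++ (bernList n)) (trans (cong (_+ 1) (length-bernList n)) (ℕ.+-comm (suc n) 1))

  nth-bernList : ∀ {n k} → k ≤ n → nth (bernList n) k ≡ B k
  nth-bernList {zero}  z≤n = refl
  nth-bernList {suc n} {k} k≤1+n with k ℕ.≟ suc n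
  ... | yes refl = refl
  ... | no k≢1+n = trans (nth-++ˡ (bernList n) _ (subst (k <_) (sym (length-bernList n)) k<1+n)) (nth-bernList (ℕ.≤-pred k<1+n))
    where k<1+n = ℕ.≤∧≢⇒< k≤1+n k≢1+n

B-suc : ∀ m → B (suc m) ≡ -ℚ (inv (suc (suc m)) *ℚ Σℚ (suc m) (λ k → toℚ (suc (suc m) C k) *ℚ B k))
B-suc m = trans (subst (λ l → nth (bernList m ++ Bₘ₊₁ ∷ []) l ≡ Bₘ₊₁) (length-bernList m) (nth-++-last (bernList m) Bₘ₊₁))
  (cong (λ s → -ℚ (inv (suc (suc m)) *ℚ s))
        (Σℚ-cong (suc m) (λ k k<1+m → cong (toℚ (suc (suc m) C k) *ℚ_) (nth-bernList (ℕ.≤-pred k<1+m)))))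
  where Bₘ₊₁ = -ℚ (inv (suc (suc m)) *ℚ Σℚ (suc m) (λ k → toℚ (suc (suc m) C k) *ℚ nth (bernList m) k))

bernoulli-recurrence : ∀ m → Σℚ (suc (suc m)) (λ k → toℚ (suc (suc m) C k) *ℚ B k) ≡ 0ℚ
bernoulli-recurrence m = begin
  s +ℚ toℚ (suc (suc m) C suc m) *ℚ B (suc m)     ≡⟨ cong₂ (λ c b → s +ℚ toℚ c *ℚ b) ([n+1]Cn≡n+1 (suc m)) (B-suc m) ⟩
  s +ℚ toℚ (suc (suc m)) *ℚ (-ℚ (inv (suc (suc m)) *ℚ s))
    ≡⟨ solve 3 (λ s a i → s :+ a :* (:- (i :* s)) := s :- (a :* i) :* s) refl s (toℚ (suc (suc m))) (inv (suc (suc m))) ⟩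
  s -ℚ (toℚ (suc (suc m)) *ℚ inv (suc (suc m))) *ℚ s ≡⟨ cong (λ u → s -ℚ u *ℚ s) (toℚ*inv≡1 (suc m)) ⟩
  s -ℚ 1ℚ *ℚ s                                    ≡⟨ solve 1 (λ s → s :- con 1ℚ :* s := con 0ℚ) refl s ⟩
  0ℚ                                              ∎
  where
  open ≡-Reasoning
  s = Σℚ (suc m) (λ k → toℚ (suc (suc m) C k) *ℚ B k)

δ₁ : ℕ → ℚ
δ₁ 1 = 1ℚ
δ₁ _ = 0ℚ

δ₁-≢1 : ∀ {m} → m ≢ 1 → δ₁ m ≡ 0ℚ
δ₁-≢1 {zero}        _   = refl
δ₁-≢1 {suc zero}    m≢1 = ⊥-elim (m≢1 refl)
δ₁-≢1 {suc (suc m)} _   = refl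

Σ-binomial-B : ∀ M → Σℚ (suc M) (λ k → toℚ (M C k) *ℚ B k) ≡ B M +ℚ δ₁ M
Σ-binomial-B zero          = refl
Σ-binomial-B (suc zero)    = solve 1 (λ b → con 0ℚ :+ con 1ℚ :* con 1ℚ :+ con 1ℚ :* b := b :+ con 1ℚ) refl (B 1)
Σ-binomial-B (suc (suc m)) = begin
  Σℚ (suc (suc m)) (λ k → toℚ (suc (suc m) C k) *ℚ B k) +ℚ toℚ (suc (suc m) C suc (suc m)) *ℚ B (suc (suc m))
    ≡⟨ cong₂ (λ s c → s +ℚ toℚ c *ℚ B (suc (suc m))) (bernoulli-recurrence m) (nCn≡1 (suc (suc m))) ⟩
  0ℚ +ℚ 1ℚ *ℚ B (suc (suc m))  ≡⟨ solve 1 (λ b → con 0ℚ :+ con 1ℚ :* b := b :+ con 0ℚ) refl (B (suc (suc m))) ⟩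
  B (suc (suc m)) +ℚ 0ℚ        ∎
  where
  open ≡-Reasoning

bernoulliPoly : ℕ → ℚ → ℚ
bernoulliPoly N x = Σℚ (suc N) (λ k → toℚ (N C k) *ℚ (B k *ℚ x ^ℚ (N ∸ k)))

bernoulliPoly-reversed : ∀ N x → Σℚ (suc N) (λ i → toℚ (N C i) *ℚ x ^ℚ i *ℚ B (N ∸ i)) ≡ bernoulliPoly N x
bernoulliPoly-reversed N x = trans (Σℚ-reverse (suc N) _) (Σℚ-cong (suc N) term)
  where
  term : ∀ k → k < suc N → toℚ (N C (N ∸ k)) *ℚ x ^ℚ (N ∸ k) *ℚ B (N ∸ (N ∸ k)) ≡ toℚ (N C k) *ℚ (B k *ℚ x ^ℚ (N ∸ k))
  term k (s≤s k≤N) = trans (cong₂ (λ c j → toℚ c *ℚ x ^ℚ (N ∸ k) *ℚ B j) (sym (nCk≡nC[n∸k] k≤N)) (ℕ.m∸[m∸n]≡n k≤N))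
    (solve 3 (λ c w b → c :* w :* b := c :* (b :* w)) refl (toℚ (N C k)) (x ^ℚ (N ∸ k)) (B k))

Σ-binomial-δ₁ : ∀ N x → Σℚ (suc N) (λ i → toℚ (N C i) *ℚ x ^ℚ i *ℚ δ₁ (N ∸ i)) ≡ toℚ N *ℚ x ^ℚ (N ∸ 1)
Σ-binomial-δ₁ zero    x = solve 1 (λ w → con 0ℚ :+ con 1ℚ :* con 1ℚ :* con 0ℚ := con 0ℚ :* w) refl (x ^ℚ 0)
Σ-binomial-δ₁ (suc N) x = begin
  Σℚ (suc (suc N)) (λ i → toℚ (suc N C i) *ℚ x ^ℚ i *ℚ δ₁ (suc N ∸ i))
    ≡⟨ Σℚ-single (suc (suc N)) N _ (ℕ.m<n⇒m<1+n ℕ.≤-refl) others ⟩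
  toℚ (suc N C N) *ℚ x ^ℚ N *ℚ δ₁ (suc N ∸ N)
    ≡⟨ cong₂ (λ c e → toℚ c *ℚ x ^ℚ N *ℚ δ₁ e) ([n+1]Cn≡n+1 N) (ℕ.m+n∸n≡m 1 N) ⟩
  toℚ (suc N) *ℚ x ^ℚ N *ℚ 1ℚ                                         ≡⟨ ℚ.*-identityʳ (toℚ (suc N) *ℚ x ^ℚ N) ⟩
  toℚ (suc N) *ℚ x ^ℚ N                                               ∎
  where
  open ≡-Reasoning
  others : ∀ k → k < suc (suc N) → k ≢ N → toℚ (suc N C k) *ℚ x ^ℚ k *ℚ δ₁ (suc N ∸ k) ≡ 0ℚ
  others k (s≤s k≤1+N) k≢N = trans (cong (toℚ (suc N C k) *ℚ x ^ℚ k *ℚ_) (δ₁-≢1 1+N∸k≢1)) (ℚ.*-zeroʳ (toℚ (suc N C k) *ℚ x ^ℚ k))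
    where
    1+N∸k≢1 : suc N ∸ k ≢ 1
    1+N∸k≢1 eq = k≢N (ℕ.+-cancelʳ-≡ 1 k N (trans (cong (k +_) (sym eq)) (trans (ℕ.m+[n∸m]≡n k≤1+N) (ℕ.+-comm 1 N))))

shiftTerm : ℕ → ℚ → ℕ → ℕ → ℚ
shiftTerm N x k i = toℚ (N C k) *ℚ (B k *ℚ (toℚ ((N ∸ k) C i) *ℚ x ^ℚ i))

bernoulliPoly-expand : ∀ N x → bernoulliPoly N (x +ℚ 1ℚ) ≡ Σℚ (suc N) (λ k → Σℚ (suc N ∸ k) (shiftTerm N x k))
bernoulliPoly-expand N x = Σℚ-cong (suc N) expand
  where
  open ≡-Reasoning
  expand : ∀ k → k < suc N → toℚ (N C k) *ℚ (B k *ℚ (x +ℚ 1ℚ) ^ℚ (N ∸ k)) ≡ Σℚ (suc N ∸ k) (shiftTerm N x k)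
  expand k (s≤s k≤N) = begin
    toℚ (N C k) *ℚ (B k *ℚ (x +ℚ 1ℚ) ^ℚ (N ∸ k))
      ≡⟨ cong (λ s → toℚ (N C k) *ℚ (B k *ℚ s)) (binomial x (N ∸ k)) ⟩
    toℚ (N C k) *ℚ (B k *ℚ Σℚ (suc (N ∸ k)) (λ i → toℚ ((N ∸ k) C i) *ℚ x ^ℚ i))
      ≡⟨ cong (toℚ (N C k) *ℚ_) (*-distribˡ-Σℚ (suc (N ∸ k)) (B k) _) ⟩
    toℚ (N C k) *ℚ Σℚ (suc (N ∸ k)) (λ i → B k *ℚ (toℚ ((N ∸ k) C i) *ℚ x ^ℚ i))
      ≡⟨ *-distribˡ-Σℚ (suc (N ∸ k)) (toℚ (N C k)) _ ⟩
    Σℚ (suc (N ∸ k)) (shiftTerm N x k)  ≡⟨ cong (λ l → Σℚ l (shiftTerm N x k)) (ℕ.+-∸-assoc 1 k≤N) ⟨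
    Σℚ (suc N ∸ k) (shiftTerm N x k)    ∎

bernoulliPoly-shift-column : ∀ N x i → i ≤ N →
  Σℚ (suc N ∸ i) (λ k → shiftTerm N x k i) ≡ toℚ (N C i) *ℚ x ^ℚ i *ℚ B (N ∸ i) +ℚ toℚ (N C i) *ℚ x ^ℚ i *ℚ δ₁ (N ∸ i)
bernoulliPoly-shift-column N x i i≤N = begin
  Σℚ (suc N ∸ i) (λ k → shiftTerm N x k i)     ≡⟨ cong (λ l → Σℚ l (λ k → shiftTerm N x k i)) (ℕ.+-∸-assoc 1 i≤N) ⟩
  Σℚ (suc (N ∸ i)) (λ k → shiftTerm N x k i)   ≡⟨ Σℚ-cong (suc (N ∸ i)) (λ k k<1+N∸i → regroup k (ℕ.≤-pred k<1+N∸i)) ⟩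
  Σℚ (suc (N ∸ i)) (λ k → c *ℚ (toℚ ((N ∸ i) C k) *ℚ B k))
    ≡⟨ *-distribˡ-Σℚ (suc (N ∸ i)) c (λ k → toℚ ((N ∸ i) C k) *ℚ B k) ⟨
  c *ℚ Σℚ (suc (N ∸ i)) (λ k → toℚ ((N ∸ i) C k) *ℚ B k)  ≡⟨ cong (c *ℚ_) (Σ-binomial-B (N ∸ i)) ⟩
  c *ℚ (B (N ∸ i) +ℚ δ₁ (N ∸ i))                            ≡⟨ ℚ.*-distribˡ-+ c (B (N ∸ i)) (δ₁ (N ∸ i)) ⟩
  c *ℚ B (N ∸ i) +ℚ c *ℚ δ₁ (N ∸ i)                        ∎
  where
  open ≡-Reasoning
  c = toℚ (N C i) *ℚ x ^ℚ i
  regroup : ∀ k → k ≤ N ∸ i → shiftTerm N x k i ≡ c *ℚ (toℚ ((N ∸ i) C k) *ℚ B k)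
  regroup k k≤N∸i = begin
    shiftTerm N x k i
      ≡⟨ solve 4 (λ a b d w → a :* (b :* (d :* w)) := (a :* d) :* (w :* b)) refl (toℚ (N C k)) (B k) (toℚ ((N ∸ k) C i)) (x ^ℚ i) ⟩
    (toℚ (N C k) *ℚ toℚ ((N ∸ k) C i)) *ℚ (x ^ℚ i *ℚ B k)
      ≡⟨ cong (_*ℚ (x ^ℚ i *ℚ B k)) (trans (sym (toℚ-* (N C k) _)) (trans (cong toℚ swap) (toℚ-* (N C i) _))) ⟩
    (toℚ (N C i) *ℚ toℚ ((N ∸ i) C k)) *ℚ (x ^ℚ i *ℚ B k)
      ≡⟨ solve 4 (λ a d w b → (a :* d) :* (w :* b) := (a :* w) :* (d :* b)) refl (toℚ (N C i)) (toℚ ((N ∸ i) C k)) (x ^ℚ i) (B k) ⟩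
    c *ℚ (toℚ ((N ∸ i) C k) *ℚ B k) ∎
    where
    swap : (N C k) * ((N ∸ k) C i) ≡ (N C i) * ((N ∸ i) C k)
    swap = nCk*[n∸k]Ci≡nCi*[n∸i]Ck N k i (subst (k + i ≤_) (ℕ.m∸n+n≡m i≤N) (ℕ.+-monoˡ-≤ i k≤N∸i))

bernoulliPoly-step : ∀ N x → bernoulliPoly N (x +ℚ 1ℚ) ≡ bernoulliPoly N x +ℚ toℚ N *ℚ x ^ℚ (N ∸ 1)
bernoulliPoly-step N x = begin
  bernoulliPoly N (x +ℚ 1ℚ)                                        ≡⟨ bernoulliPoly-expand N x ⟩
  Σℚ (suc N) (λ k → Σℚ (suc N ∸ k) (shiftTerm N x k))              ≡⟨ Σℚ-triangle-swap (suc N) (shiftTerm N x) ⟩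
  Σℚ (suc N) (λ i → Σℚ (suc N ∸ i) (λ k → shiftTerm N x k i))
    ≡⟨ Σℚ-cong (suc N) (λ i i<1+N → bernoulliPoly-shift-column N x i (ℕ.≤-pred i<1+N)) ⟩
  Σℚ (suc N) (λ i → c i *ℚ B (N ∸ i) +ℚ c i *ℚ δ₁ (N ∸ i))         ≡⟨ Σℚ-+ (suc N) _ _ ⟩
  Σℚ (suc N) (λ i → c i *ℚ B (N ∸ i)) +ℚ Σℚ (suc N) (λ i → c i *ℚ δ₁ (N ∸ i))
    ≡⟨ cong₂ _+ℚ_ (bernoulliPoly-reversed N x) (Σ-binomial-δ₁ N x) ⟩
  bernoulliPoly N x +ℚ toℚ N *ℚ x ^ℚ (N ∸ 1)                      ∎
  where
  open ≡-Reasoning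
  c : ℕ → ℚ
  c i = toℚ (N C i) *ℚ x ^ℚ i

bernoulliPoly-0 : ∀ N → bernoulliPoly N 0ℚ ≡ B N
bernoulliPoly-0 N = begin
  bernoulliPoly N 0ℚ                       ≡⟨ Σℚ-single (suc N) N _ ℕ.≤-refl others ⟩
  toℚ (N C N) *ℚ (B N *ℚ 0ℚ ^ℚ (N ∸ N))   ≡⟨ cong₂ (λ c e → toℚ c *ℚ (B N *ℚ 0ℚ ^ℚ e)) (nCn≡1 N) (ℕ.n∸n≡0 N) ⟩
  1ℚ *ℚ (B N *ℚ 1ℚ)                        ≡⟨ solve 1 (λ b → con 1ℚ :* (b :* con 1ℚ) := b) refl (B N) ⟩
  B N                                      ∎
  where
  open ≡-Reasoning
  0^ℚpos≡0 : ∀ {e} → 0 < e → 0ℚ ^ℚ e ≡ 0ℚ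
  0^ℚpos≡0 {suc e} _ = ℚ.*-zeroˡ (0ℚ ^ℚ e)
  others : ∀ k → k < suc N → k ≢ N → toℚ (N C k) *ℚ (B k *ℚ 0ℚ ^ℚ (N ∸ k)) ≡ 0ℚ
  others k (s≤s k≤N) k≢N =
    trans (cong (λ z → toℚ (N C k) *ℚ (B k *ℚ z)) (0^ℚpos≡0 (ℕ.m<n⇒0<n∸m (ℕ.≤∧≢⇒< k≤N k≢N))))
          (solve 2 (λ a b → a :* (b :* con 0ℚ) := con 0ℚ) refl (toℚ (N C k)) (B k))

powerSum : ℕ → ℕ → ℚ
powerSum m k = Σℚ m (λ a → toℚ a ^ℚ k)

faulhaber : ∀ n m → toℚ (suc n) *ℚ powerSum m n ≡ bernoulliPoly (suc n) (toℚ m) -ℚ B (suc n)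
faulhaber n zero = begin
  toℚ (suc n) *ℚ 0ℚ                          ≡⟨ ℚ.*-zeroʳ (toℚ (suc n)) ⟩
  0ℚ                                         ≡⟨ ℚ.+-inverseʳ (B (suc n)) ⟨
  B (suc n) -ℚ B (suc n)                     ≡⟨ cong (_-ℚ B (suc n)) (bernoulliPoly-0 (suc n)) ⟨
  bernoulliPoly (suc n) 0ℚ -ℚ B (suc n)      ∎
  where
  open ≡-Reasoning
faulhaber n (suc m) = begin
  toℚ (suc n) *ℚ (powerSum m n +ℚ x ^ℚ n)                 ≡⟨ ℚ.*-distribˡ-+ (toℚ (suc n)) (powerSum m n) (x ^ℚ n) ⟩
  toℚ (suc n) *ℚ powerSum m n +ℚ toℚ (suc n) *ℚ x ^ℚ n    ≡⟨ cong (_+ℚ toℚ (suc n) *ℚ x ^ℚ n) (faulhaber n m) ⟩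
  (P x -ℚ B (suc n)) +ℚ toℚ (suc n) *ℚ x ^ℚ n
    ≡⟨ solve 3 (λ a b c → (a :- b) :+ c := (a :+ c) :- b) refl (P x) (B (suc n)) (toℚ (suc n) *ℚ x ^ℚ n) ⟩
  (P x +ℚ toℚ (suc n) *ℚ x ^ℚ n) -ℚ B (suc n)             ≡⟨ cong (_-ℚ B (suc n)) (bernoulliPoly-step (suc n) x) ⟨
  P (x +ℚ 1ℚ) -ℚ B (suc n)                                ≡⟨ cong (λ y → P y -ℚ B (suc n)) (toℚ-suc m) ⟨
  P (toℚ (suc m)) -ℚ B (suc n)                            ∎
  where
  open ≡-Reasoning
  x = toℚ m
  P = bernoulliPoly (suc n)

inv*toℚ≡toℚ*inv : ∀ {a b x y} → suc a * x ≡ suc b * y → inv (suc b) *ℚ toℚ x ≡ toℚ y *ℚ inv (suc a)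
inv*toℚ≡toℚ*inv {a} {b} {x} {y} eq = begin
  inv (suc b) *ℚ toℚ x
    ≡⟨ ℚ.*-identityʳ (inv (suc b) *ℚ toℚ x) ⟨
  inv (suc b) *ℚ toℚ x *ℚ 1ℚ                             ≡⟨ cong (inv (suc b) *ℚ toℚ x *ℚ_) (toℚ*inv≡1 a) ⟨
  inv (suc b) *ℚ toℚ x *ℚ (toℚ (suc a) *ℚ inv (suc a))
    ≡⟨ solve 4 (λ i x A j → i :* x :* (A :* j) := i :* (A :* x) :* j) refl (inv (suc b)) (toℚ x) (toℚ (suc a)) (inv (suc a)) ⟩
  inv (suc b) *ℚ (toℚ (suc a) *ℚ toℚ x) *ℚ inv (suc a)   ≡⟨ cong (λ z → inv (suc b) *ℚ z *ℚ inv (suc a)) cross ⟩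
  inv (suc b) *ℚ (toℚ (suc b) *ℚ toℚ y) *ℚ inv (suc a)
    ≡⟨ solve 4 (λ i B y j → i :* (B :* y) :* j := (B :* i) :* y :* j) refl (inv (suc b)) (toℚ (suc b)) (toℚ y) (inv (suc a)) ⟩
  (toℚ (suc b) *ℚ inv (suc b)) *ℚ toℚ y *ℚ inv (suc a)   ≡⟨ cong (λ z → z *ℚ toℚ y *ℚ inv (suc a)) (toℚ*inv≡1 b) ⟩
  1ℚ *ℚ toℚ y *ℚ inv (suc a)                             ≡⟨ cong (_*ℚ inv (suc a)) (ℚ.*-identityˡ (toℚ y)) ⟩
  toℚ y *ℚ inv (suc a)                                   ∎
  where
  open ≡-Reasoning
  cross : toℚ (suc a) *ℚ toℚ x ≡ toℚ (suc b) *ℚ toℚ y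
  cross = trans (sym (toℚ-* (suc a) x)) (trans (cong toℚ eq) (toℚ-* (suc b) y))

faulhaberTerm : ℕ → ℕ → ℕ → ℚ
faulhaberTerm m n ν = toℚ (n C ν) *ℚ (B (n ∸ ν) *ℚ (toℚ (m ^ ν) *ℚ inv (suc ν)))

bernoulliPoly-term≡faulhaberTerm : ∀ m n ν → ν ≤ n →
  toℚ (suc n C (n ∸ ν)) *ℚ (B (n ∸ ν) *ℚ toℚ m ^ℚ (suc n ∸ (n ∸ ν))) ≡ toℚ (suc n) *ℚ (toℚ m *ℚ faulhaberTerm m n ν)
bernoulliPoly-term≡faulhaberTerm m n ν ν≤n = *-cancelˡ-toℚ ν (begin
  toℚ (suc ν) *ℚ (toℚ (suc n C (n ∸ ν)) *ℚ (B (n ∸ ν) *ℚ x ^ℚ (suc n ∸ (n ∸ ν))))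
    ≡⟨ cong₂ (λ c e → toℚ (suc ν) *ℚ (toℚ c *ℚ (B (n ∸ ν) *ℚ x ^ℚ e)))
             (trans (nCk≡nC[n∸k] (ℕ.m≤n⇒m≤1+n (ℕ.m∸n≤m n ν))) (cong (suc n C_) exponent)) exponent ⟩
  toℚ (suc ν) *ℚ (toℚ (suc n C suc ν) *ℚ (B (n ∸ ν) *ℚ x ^ℚ suc ν))
    ≡⟨ solve 3 (λ a c w → a :* (c :* w) := (a :* c) :* w) refl (toℚ (suc ν)) (toℚ (suc n C suc ν)) (B (n ∸ ν) *ℚ x ^ℚ suc ν) ⟩
  (toℚ (suc ν) *ℚ toℚ (suc n C suc ν)) *ℚ (B (n ∸ ν) *ℚ x ^ℚ suc ν)
    ≡⟨ cong₂ (λ c w → c *ℚ (B (n ∸ ν) *ℚ (x *ℚ w))) absorb (sym (toℚ-^ m ν)) ⟩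
  t                                            ≡⟨ ℚ.*-identityʳ t ⟨
  t *ℚ 1ℚ                                      ≡⟨ cong (t *ℚ_) (toℚ*inv≡1 ν) ⟨
  t *ℚ (toℚ (suc ν) *ℚ inv (suc ν))
    ≡⟨ solve 7 (λ ν n c b x w i → (n :* c) :* (b :* (x :* w)) :* (ν :* i) := ν :* (n :* (x :* (c :* (b :* (w :* i))))))
         refl (toℚ (suc ν)) (toℚ (suc n)) (toℚ (n C ν)) (B (n ∸ ν)) x (toℚ (m ^ ν)) (inv (suc ν)) ⟩
  toℚ (suc ν) *ℚ (toℚ (suc n) *ℚ (x *ℚ faulhaberTerm m n ν)) ∎)
  where
  open ≡-Reasoning
  x = toℚ m
  t = (toℚ (suc n) *ℚ toℚ (n C ν)) *ℚ (B (n ∸ ν) *ℚ (x *ℚ toℚ (m ^ ν)))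
  exponent : suc n ∸ (n ∸ ν) ≡ suc ν
  exponent = trans (ℕ.+-∸-assoc 1 (ℕ.m∸n≤m n ν)) (cong suc (ℕ.m∸[m∸n]≡n ν≤n))
  absorb : toℚ (suc ν) *ℚ toℚ (suc n C suc ν) ≡ toℚ (suc n) *ℚ toℚ (n C ν)
  absorb = trans (sym (toℚ-* (suc ν) (suc n C suc ν))) (trans (cong toℚ ([k+1]*[n+1]C[k+1]≡[n+1]*nCk n ν)) (toℚ-* (suc n) (n C ν)))

powerSum-expansion : ∀ m n → powerSum m n ≡ toℚ m *ℚ (B n +ℚ Σℚ n (λ ν → faulhaberTerm m n (suc ν)))
powerSum-expansion m n = *-cancelˡ-toℚ n (begin
  toℚ (suc n) *ℚ powerSum m n                           ≡⟨ faulhaber n m ⟩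
  (Σℚ (suc n) g +ℚ g (suc n)) -ℚ B (suc n)              ≡⟨ cong (λ z → (Σℚ (suc n) g +ℚ z) -ℚ B (suc n)) last ⟩
  (Σℚ (suc n) g +ℚ B (suc n)) -ℚ B (suc n)              ≡⟨ solve 2 (λ a b → (a :+ b) :- b := a) refl (Σℚ (suc n) g) (B (suc n)) ⟩
  Σℚ (suc n) g                                          ≡⟨ Σℚ-reverse (suc n) g ⟩
  Σℚ (suc n) (λ ν → g (n ∸ ν))
    ≡⟨ Σℚ-cong (suc n) (λ ν ν<1+n → bernoulliPoly-term≡faulhaberTerm m n ν (ℕ.≤-pred ν<1+n)) ⟩
  Σℚ (suc n) (λ ν → toℚ (suc n) *ℚ (x *ℚ faulhaberTerm m n ν)) ≡⟨ *-distribˡ-Σℚ (suc n) (toℚ (suc n)) _ ⟨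
  toℚ (suc n) *ℚ Σℚ (suc n) (λ ν → x *ℚ faulhaberTerm m n ν)   ≡⟨ cong (toℚ (suc n) *ℚ_) (*-distribˡ-Σℚ (suc n) x _) ⟨
  toℚ (suc n) *ℚ (x *ℚ Σℚ (suc n) (faulhaberTerm m n))
    ≡⟨ cong (λ z → toℚ (suc n) *ℚ (x *ℚ z)) (Σℚ-first n (faulhaberTerm m n)) ⟩
  toℚ (suc n) *ℚ (x *ℚ (faulhaberTerm m n 0 +ℚ Σℚ n (λ ν → faulhaberTerm m n (suc ν))))
    ≡⟨ cong (λ z → toℚ (suc n) *ℚ (x *ℚ (z +ℚ Σℚ n (λ ν → faulhaberTerm m n (suc ν))))) first ⟩
  toℚ (suc n) *ℚ (x *ℚ (B n +ℚ Σℚ n (λ ν → faulhaberTerm m n (suc ν)))) ∎)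
  where
  open ≡-Reasoning
  x = toℚ m
  g : ℕ → ℚ
  g k = toℚ (suc n C k) *ℚ (B k *ℚ x ^ℚ (suc n ∸ k))
  last : g (suc n) ≡ B (suc n)
  last = trans (cong₂ (λ c e → toℚ c *ℚ (B (suc n) *ℚ x ^ℚ e)) (nCn≡1 (suc n)) (ℕ.n∸n≡0 n))
               (solve 1 (λ b → con 1ℚ :* (b :* con 1ℚ) := b) refl (B (suc n)))
  first : faulhaberTerm m n 0 ≡ B n
  first = solve 1 (λ b → con 1ℚ :* (b :* (con 1ℚ :* con 1ℚ)) := b) refl (B n)

binomial-transform-injective : ∀ {u v : ℕ → ℚ} →
  (∀ N → Σℚ (suc N) (λ k → toℚ (suc N C k) *ℚ u k) ≡ Σℚ (suc N) (λ k → toℚ (suc N C k) *ℚ v k)) →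
  ∀ k → u k ≡ v k
binomial-transform-injective {u} {v} transform≡ = <-rec (λ k → u k ≡ v k) step
  where
  step : ∀ k → (∀ {i} → i < k → u i ≡ v i) → u k ≡ v k
  step k ih = *-cancelˡ-toℚ k (begin
    toℚ (suc k) *ℚ u k                                 ≡⟨ cong (λ c → toℚ c *ℚ u k) ([n+1]Cn≡n+1 k) ⟨
    toℚ (suc k C k) *ℚ u k
      ≡⟨ solve 2 (λ a x → x := (a :+ x) :- a) refl (lower u) (toℚ (suc k C k) *ℚ u k) ⟩
    (lower u +ℚ toℚ (suc k C k) *ℚ u k) -ℚ lower u
      ≡⟨ cong₂ _-ℚ_ (transform≡ k) (Σℚ-cong k (λ i i<k → cong (toℚ (suc k C i) *ℚ_) (ih i<k))) ⟩
    (lower v +ℚ toℚ (suc k C k) *ℚ v k) -ℚ lower v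
      ≡⟨ solve 2 (λ a x → (a :+ x) :- a := x) refl (lower v) (toℚ (suc k C k) *ℚ v k) ⟩
    toℚ (suc k C k) *ℚ v k                             ≡⟨ cong (λ c → toℚ c *ℚ v k) ([n+1]Cn≡n+1 k) ⟩
    toℚ (suc k) *ℚ v k                                 ∎)
    where
    open ≡-Reasoning
    lower : (ℕ → ℚ) → ℚ
    lower w = Σℚ k (λ i → toℚ (suc k C i) *ℚ w i)

Σ-binomial-B+δ₁ : ∀ N → Σℚ (suc N) (λ k → toℚ (suc N C k) *ℚ (B k +ℚ δ₁ k)) ≡ toℚ (suc N)
Σ-binomial-B+δ₁ zero    = refl
Σ-binomial-B+δ₁ (suc m) = begin
  Σℚ (suc (suc m)) (λ k → toℚ (suc (suc m) C k) *ℚ (B k +ℚ δ₁ k))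
    ≡⟨ Σℚ-cong (suc (suc m)) (λ k _ → ℚ.*-distribˡ-+ (toℚ (suc (suc m) C k)) (B k) (δ₁ k)) ⟩
  Σℚ (suc (suc m)) (λ k → toℚ (suc (suc m) C k) *ℚ B k +ℚ toℚ (suc (suc m) C k) *ℚ δ₁ k)
    ≡⟨ Σℚ-+ (suc (suc m)) _ _ ⟩
  Σℚ (suc (suc m)) (λ k → toℚ (suc (suc m) C k) *ℚ B k) +ℚ Σℚ (suc (suc m)) (λ k → toℚ (suc (suc m) C k) *ℚ δ₁ k)
    ≡⟨ cong₂ _+ℚ_ (bernoulli-recurrence m) (Σℚ-single (suc (suc m)) 1 _ (s≤s (s≤s z≤n)) others) ⟩
  0ℚ +ℚ toℚ (suc (suc m) C 1) *ℚ 1ℚ  ≡⟨ cong (λ c → 0ℚ +ℚ toℚ c *ℚ 1ℚ) (nC1≡n (suc (suc m))) ⟩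
  0ℚ +ℚ toℚ (suc (suc m)) *ℚ 1ℚ      ≡⟨ solve 1 (λ n → con 0ℚ :+ n :* con 1ℚ := n) refl (toℚ (suc (suc m))) ⟩
  toℚ (suc (suc m))                  ∎
  where
  open ≡-Reasoning
  others : ∀ k → k < suc (suc m) → k ≢ 1 → toℚ (suc (suc m) C k) *ℚ δ₁ k ≡ 0ℚ
  others k _ k≢1 = trans (cong (toℚ (suc (suc m) C k) *ℚ_) (δ₁-≢1 k≢1)) (ℚ.*-zeroʳ (toℚ (suc (suc m) C k)))

-1ℚ : ℚ
-1ℚ = -ℚ 1ℚ

1^ℚk≡1 : ∀ k → 1ℚ ^ℚ k ≡ 1ℚ
1^ℚk≡1 zero    = refl
1^ℚk≡1 (suc k) = trans (ℚ.*-identityˡ (1ℚ ^ℚ k)) (1^ℚk≡1 k)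

[-1]^k*[-1]^k≡1 : ∀ k → -1ℚ ^ℚ k *ℚ -1ℚ ^ℚ k ≡ 1ℚ
[-1]^k*[-1]^k≡1 k = trans (sym (^-distrib-* -1ℚ -1ℚ k)) (1^ℚk≡1 k)

[-1]^k≡[-1]^n*[-1]^[n∸k] : ∀ {k n} → k ≤ n → -1ℚ ^ℚ k ≡ -1ℚ ^ℚ n *ℚ -1ℚ ^ℚ (n ∸ k)
[-1]^k≡[-1]^n*[-1]^[n∸k] {k} {n} k≤n = begin
  -1ℚ ^ℚ k                 ≡⟨ ℚ.*-identityˡ (-1ℚ ^ℚ k) ⟨
  1ℚ *ℚ -1ℚ ^ℚ k           ≡⟨ cong (_*ℚ -1ℚ ^ℚ k) ([-1]^k*[-1]^k≡1 (n ∸ k)) ⟨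
  (u *ℚ u) *ℚ -1ℚ ^ℚ k     ≡⟨ solve 2 (λ u a → (u :* u) :* a := (u :* a) :* u) refl u (-1ℚ ^ℚ k) ⟩
  (u *ℚ -1ℚ ^ℚ k) *ℚ u     ≡⟨ cong (_*ℚ u) (trans (sym (^-homo-* -1ℚ (n ∸ k) k)) (cong (-1ℚ ^ℚ_) (ℕ.m∸n+n≡m k≤n))) ⟩
  -1ℚ ^ℚ n *ℚ u            ∎
  where
  open ≡-Reasoning
  u = -1ℚ ^ℚ (n ∸ k)

bernoulliPoly-[-1] : ∀ N → bernoulliPoly (suc N) -1ℚ ≡ B (suc N) -ℚ toℚ (suc N) *ℚ -1ℚ ^ℚ N
bernoulliPoly-[-1] N = trans (solve 2 (λ a b → a := (a :+ b) :- b) refl (bernoulliPoly (suc N) -1ℚ) (toℚ (suc N) *ℚ -1ℚ ^ℚ N))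
  (cong (_-ℚ toℚ (suc N) *ℚ -1ℚ ^ℚ N) (trans (sym (bernoulliPoly-step (suc N) -1ℚ)) (bernoulliPoly-0 (suc N))))

Σ-binomial-signedB : ∀ N → Σℚ (suc N) (λ k → toℚ (suc N C k) *ℚ (-1ℚ ^ℚ k *ℚ B k)) ≡ toℚ (suc N)
Σ-binomial-signedB N = begin
  Σℚ (suc N) c                                        ≡⟨ solve 2 (λ s x → s := (s :+ x) :- x) refl (Σℚ (suc N) c) (c (suc N)) ⟩
  (Σℚ (suc N) c +ℚ c (suc N)) -ℚ c (suc N)            ≡⟨ cong₂ _-ℚ_ full last ⟩
  (s *ℚ B (suc N) +ℚ toℚ (suc N)) -ℚ s *ℚ B (suc N)  ≡⟨ solve 2 (λ x n → (x :+ n) :- x := n) refl (s *ℚ B (suc N)) (toℚ (suc N)) ⟩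
  toℚ (suc N)                                         ∎
  where
  open ≡-Reasoning
  s = -1ℚ ^ℚ suc N
  c : ℕ → ℚ
  c k = toℚ (suc N C k) *ℚ (-1ℚ ^ℚ k *ℚ B k)
  last : c (suc N) ≡ s *ℚ B (suc N)
  last = trans (cong (λ t → toℚ t *ℚ (s *ℚ B (suc N))) (nCn≡1 (suc N))) (ℚ.*-identityˡ (s *ℚ B (suc N)))
  reorder : ∀ k → k ≤ suc N → c k ≡ s *ℚ (toℚ (suc N C k) *ℚ (B k *ℚ -1ℚ ^ℚ (suc N ∸ k)))
  reorder k k≤1+N = trans (cong (λ z → toℚ (suc N C k) *ℚ (z *ℚ B k)) ([-1]^k≡[-1]^n*[-1]^[n∸k] k≤1+N))
    (solve 4 (λ c s u b → c :* ((s :* u) :* b) := s :* (c :* (b :* u))) refl (toℚ (suc N C k)) s (-1ℚ ^ℚ (suc N ∸ k)) (B k))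
  full : Σℚ (suc (suc N)) c ≡ s *ℚ B (suc N) +ℚ toℚ (suc N)
  full = begin
    Σℚ (suc (suc N)) c                                   ≡⟨ Σℚ-cong (suc (suc N)) (λ k k<2+N → reorder k (ℕ.≤-pred k<2+N)) ⟩
    Σℚ (suc (suc N)) (λ k → s *ℚ (toℚ (suc N C k) *ℚ (B k *ℚ -1ℚ ^ℚ (suc N ∸ k))))
                                                         ≡⟨ *-distribˡ-Σℚ (suc (suc N)) s _ ⟨
    s *ℚ bernoulliPoly (suc N) -1ℚ                       ≡⟨ cong (s *ℚ_) (bernoulliPoly-[-1] N) ⟩
    s *ℚ (B (suc N) -ℚ toℚ (suc N) *ℚ -1ℚ ^ℚ N)
      ≡⟨ solve 3 (λ b n t → (con -1ℚ :* t) :* (b :- n :* t) := (con -1ℚ :* t) :* b :+ n :* (t :* t))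
                 refl (B (suc N)) (toℚ (suc N)) (-1ℚ ^ℚ N) ⟩
    s *ℚ B (suc N) +ℚ toℚ (suc N) *ℚ (-1ℚ ^ℚ N *ℚ -1ℚ ^ℚ N)
      ≡⟨ cong (λ z → s *ℚ B (suc N) +ℚ toℚ (suc N) *ℚ z) ([-1]^k*[-1]^k≡1 N) ⟩
    s *ℚ B (suc N) +ℚ toℚ (suc N) *ℚ 1ℚ                  ≡⟨ cong (s *ℚ B (suc N) +ℚ_) (ℚ.*-identityʳ (toℚ (suc N))) ⟩
    s *ℚ B (suc N) +ℚ toℚ (suc N)                        ∎

[-1]^[1+q*2]≡-1 : ∀ q → -1ℚ ^ℚ (1 + q * 2) ≡ -1ℚ
[-1]^[1+q*2]≡-1 zero    = refl
[-1]^[1+q*2]≡-1 (suc q) = trans (solve 1 (λ t → con -1ℚ :* (con -1ℚ :* t) := t) refl (-1ℚ ^ℚ (1 + q * 2))) ([-1]^[1+q*2]≡-1 q)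

¬2∣⇒odd : ∀ {m} → ¬ 2 ∣ m → ∃ λ q → m ≡ 1 + q * 2
¬2∣⇒odd {m} 2∤m with m ℕ.% 2 | ℕ.m%n<n m 2 | ℕ.m≡m%n+[m/n]*n m 2
... | zero        | _            | eq = ⊥-elim (2∤m (divides (m ℕ./ 2) eq))
... | suc zero    | _            | eq = m ℕ./ 2 , eq
... | suc (suc _) | s≤s (s≤s ()) | _

-- (−1)^k B_k = B_k + δ₁ k for all k: both sequences have binomial transform N + 1.
B-odd : ∀ {k} → 1 < k → ¬ 2 ∣ k → B k ≡ 0ℚ
B-odd {k} 1<k 2∤k = *-cancelˡ-toℚ 1 (begin
  toℚ 2 *ℚ B k            ≡⟨ solve 1 (λ b → con (toℚ 2) :* b := b :- con -1ℚ :* b) refl (B k) ⟩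
  B k -ℚ -1ℚ *ℚ B k       ≡⟨ cong (λ z → B k -ℚ z *ℚ B k) [-1]^k≡-1 ⟨
  B k -ℚ -1ℚ ^ℚ k *ℚ B k  ≡⟨ cong (λ z → B k -ℚ z) signed≡unsigned ⟩
  B k -ℚ (B k +ℚ δ₁ k)    ≡⟨ cong (λ z → B k -ℚ (B k +ℚ z)) (δ₁-≢1 {k} (λ { refl → ℕ.<-irrefl refl 1<k })) ⟩
  B k -ℚ (B k +ℚ 0ℚ)      ≡⟨ solve 1 (λ b → b :- (b :+ con 0ℚ) := con (toℚ 2) :* con 0ℚ) refl (B k) ⟩
  toℚ 2 *ℚ 0ℚ             ∎)
  where
  open ≡-Reasoning
  signed≡unsigned : -1ℚ ^ℚ k *ℚ B k ≡ B k +ℚ δ₁ k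
  signed≡unsigned = binomial-transform-injective (λ N → trans (Σ-binomial-signedB N) (sym (Σ-binomial-B+δ₁ N))) k
  [-1]^k≡-1 : -1ℚ ^ℚ k ≡ -1ℚ
  [-1]^k≡-1 with ¬2∣⇒odd 2∤k
  ... | q , k≡1+q*2 = trans (cong (-1ℚ ^ℚ_) k≡1+q*2) ([-1]^[1+q*2]≡-1 q)

toℚᵘ-scaled : ∀ x {d a} → x *ℚ toℚ d ≡ fromℤ a → toℚᵘ x ℚᵘ.* mkℚᵘ (ℤ.+ d) 0 ℚᵘ.≃ mkℚᵘ a 0
toℚᵘ-scaled x {d} {a} eq = begin
  toℚᵘ x ℚᵘ.* mkℚᵘ (ℤ.+ d) 0          ≈⟨ ℚᵘ.*-congˡ {toℚᵘ x} (toℚᵘ-fromℤ (ℤ.+ d)) ⟨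
  toℚᵘ x ℚᵘ.* toℚᵘ (toℚ d)            ≈⟨ ℚ.toℚᵘ-homo-* x (toℚ d) ⟨
  toℚᵘ (x *ℚ toℚ d)                   ≈⟨ ℚᵘ.≃-reflexive (cong toℚᵘ eq) ⟩
  toℚᵘ (fromℤ a)                      ≈⟨ toℚᵘ-fromℤ a ⟩
  mkℚᵘ a 0                            ∎
  where
  open ℚᵘ.≃-Reasoning

∣↥x∣*d≡∣a∣*↧x : ∀ x {d a} → x *ℚ toℚ d ≡ fromℤ a → ℤ.∣ ↥ x ∣ * d ≡ ℤ.∣ a ∣ * ↧ₙ x
∣↥x∣*d≡∣a∣*↧x x@(mkℚ n dm _) {d} {a} eq with toℚᵘ-scaled x {d} {a} eq
... | *≡* n*d*1≡a*↧x*1 = begin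
  ℤ.∣ n ∣ * d                          ≡⟨ ℤ.abs-* n (ℤ.+ d) ⟨
  ℤ.∣ n ℤ.* ℤ.+ d ∣                    ≡⟨ cong ℤ.∣_∣ (ℤ.*-identityʳ (n ℤ.* ℤ.+ d)) ⟨
  ℤ.∣ n ℤ.* ℤ.+ d ℤ.* ℤ.+ 1 ∣          ≡⟨ cong ℤ.∣_∣ n*d*1≡a*↧x*1 ⟩
  ℤ.∣ a ℤ.* ℤ.+ (suc dm * 1) ∣         ≡⟨ ℤ.abs-* a (ℤ.+ (suc dm * 1)) ⟩
  ℤ.∣ a ∣ * (suc dm * 1)               ≡⟨ cong (ℤ.∣ a ∣ *_) (ℕ.*-identityʳ (suc dm)) ⟩
  ℤ.∣ a ∣ * suc dm                     ∎
  where
  open ≡-Reasoning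

-- p-adic valuations

module Valuation {p : ℕ} (p-prime : Prime p) where

  p∤1 : ¬ p ∣ 1
  p∤1 p∣1 = ¬prime[1] (subst Prime (∣1⇒≡1 p∣1) p-prime)

  p∤m*n : ∀ {m n} → ¬ p ∣ m → ¬ p ∣ n → ¬ p ∣ m * n
  p∤m*n {m} {n} p∤m p∤n p∣m*n with euclidsLemma m n p-prime p∣m*n
  ... | inj₁ p∣m = p∤m p∣m
  ... | inj₂ p∣n = p∤n p∣n

  p∤⇒0< : ∀ {u} → ¬ p ∣ u → 0 < u
  p∤⇒0< {zero}  p∤0 = ⊥-elim (p∤0 (p ∣0))
  p∤⇒0< {suc u} _   = s≤s z≤n

  1<p : 1 < p
  1<p = ℕ.nonTrivial⇒n>1 p {{prime⇒nonTrivial p-prime}}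

  p≡1+[p∸1] : p ≡ suc (p ∸ 1)
  p≡1+[p∸1] = sym (ℕ.m+[n∸m]≡n (ℕ.<⇒≤ 1<p))

  infix 4 _≤ᵥ_

  -- r ≤ᵥ x says that the p-adic valuation of x is at least r.
  record _≤ᵥ_ (r : ℕ) (x : ℚ) : Set where
    constructor scaled
    field
      numerator     : ℤ
      denominator   : ℕ
      p∤denominator : ¬ p ∣ denominator
      equation      : x *ℚ toℚ denominator ≡ fromℤ numerator *ℚ toℚ (p ^ r)

  ≤ᵥ-0ℚ : ∀ r → r ≤ᵥ 0ℚ
  ≤ᵥ-0ℚ r = scaled (ℤ.+ 0) 1 p∤1 (sym (ℚ.*-zeroˡ (toℚ (p ^ r))))

  0≤ᵥ-fromℤ : ∀ a → 0 ≤ᵥ fromℤ a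
  0≤ᵥ-fromℤ a = scaled a 1 p∤1 refl

  0≤ᵥ-toℚ : ∀ m → 0 ≤ᵥ toℚ m
  0≤ᵥ-toℚ m = 0≤ᵥ-fromℤ (ℤ.+ m)

  r≤ᵥp^r : ∀ r → r ≤ᵥ toℚ (p ^ r)
  r≤ᵥp^r r = scaled (ℤ.+ 1) 1 p∤1 (trans (ℚ.*-identityʳ (toℚ (p ^ r))) (sym (ℚ.*-identityˡ (toℚ (p ^ r)))))

  ≤ᵥ-+ : ∀ {r x y} → r ≤ᵥ x → r ≤ᵥ y → r ≤ᵥ (x +ℚ y)
  ≤ᵥ-+ {r} {x} {y} (scaled a d p∤d eq) (scaled a′ d′ p∤d′ eq′) =
    scaled (a ℤ.* ℤ.+ d′ ℤ.+ a′ ℤ.* ℤ.+ d) (d * d′) (p∤m*n p∤d p∤d′) (begin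
      (x +ℚ y) *ℚ toℚ (d * d′)                  ≡⟨ cong ((x +ℚ y) *ℚ_) (toℚ-* d d′) ⟩
      (x +ℚ y) *ℚ (toℚ d *ℚ toℚ d′)
        ≡⟨ solve 4 (λ x y D D′ → (x :+ y) :* (D :* D′) := (x :* D) :* D′ :+ (y :* D′) :* D) refl x y (toℚ d) (toℚ d′) ⟩
      (x *ℚ toℚ d) *ℚ toℚ d′ +ℚ (y *ℚ toℚ d′) *ℚ toℚ d  ≡⟨ cong₂ (λ u v → u *ℚ toℚ d′ +ℚ v *ℚ toℚ d) eq eq′ ⟩
      (fromℤ a *ℚ P) *ℚ toℚ d′ +ℚ (fromℤ a′ *ℚ P) *ℚ toℚ d
        ≡⟨ solve 5 (λ A A′ P D D′ → (A :* P) :* D′ :+ (A′ :* P) :* D := (A :* D′ :+ A′ :* D) :* P)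
                   refl (fromℤ a) (fromℤ a′) P (toℚ d) (toℚ d′) ⟩
      (fromℤ a *ℚ toℚ d′ +ℚ fromℤ a′ *ℚ toℚ d) *ℚ P
        ≡⟨ cong (_*ℚ P) (trans (fromℤ-+ (a ℤ.* ℤ.+ d′) (a′ ℤ.* ℤ.+ d)) (cong₂ _+ℚ_ (fromℤ-* a (ℤ.+ d′)) (fromℤ-* a′ (ℤ.+ d)))) ⟨
      fromℤ (a ℤ.* ℤ.+ d′ ℤ.+ a′ ℤ.* ℤ.+ d) *ℚ P  ∎)
    where
    open ≡-Reasoning
    P = toℚ (p ^ r)

  ≤ᵥ-neg : ∀ {r x} → r ≤ᵥ x → r ≤ᵥ (-ℚ x)
  ≤ᵥ-neg {r} {x} (scaled a d p∤d eq) = scaled (ℤ.- a) d p∤d (begin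
    (-ℚ x) *ℚ toℚ d                ≡⟨ ℚ.neg-distribˡ-* x (toℚ d) ⟨
    -ℚ (x *ℚ toℚ d)                ≡⟨ cong -ℚ_ eq ⟩
    -ℚ (fromℤ a *ℚ toℚ (p ^ r))    ≡⟨ ℚ.neg-distribˡ-* (fromℤ a) (toℚ (p ^ r)) ⟩
    (-ℚ fromℤ a) *ℚ toℚ (p ^ r)    ≡⟨ cong (_*ℚ toℚ (p ^ r)) (fromℤ-neg a) ⟨
    fromℤ (ℤ.- a) *ℚ toℚ (p ^ r)   ∎)
    where
    open ≡-Reasoning

  ≤ᵥ-sub : ∀ {r x y} → r ≤ᵥ x → r ≤ᵥ y → r ≤ᵥ (x -ℚ y)
  ≤ᵥ-sub r≤ᵥx r≤ᵥy = ≤ᵥ-+ r≤ᵥx (≤ᵥ-neg r≤ᵥy)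

  ≤ᵥ-* : ∀ {r s x y} → r ≤ᵥ x → s ≤ᵥ y → (r + s) ≤ᵥ (x *ℚ y)
  ≤ᵥ-* {r} {s} {x} {y} (scaled a d p∤d eq) (scaled a′ d′ p∤d′ eq′) = scaled (a ℤ.* a′) (d * d′) (p∤m*n p∤d p∤d′) (begin
    (x *ℚ y) *ℚ toℚ (d * d′)              ≡⟨ cong ((x *ℚ y) *ℚ_) (toℚ-* d d′) ⟩
    (x *ℚ y) *ℚ (toℚ d *ℚ toℚ d′)
      ≡⟨ solve 4 (λ x y D D′ → (x :* y) :* (D :* D′) := (x :* D) :* (y :* D′)) refl x y (toℚ d) (toℚ d′) ⟩
    (x *ℚ toℚ d) *ℚ (y *ℚ toℚ d′)         ≡⟨ cong₂ _*ℚ_ eq eq′ ⟩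
    (fromℤ a *ℚ toℚ (p ^ r)) *ℚ (fromℤ a′ *ℚ toℚ (p ^ s))
      ≡⟨ solve 4 (λ A P A′ P′ → (A :* P) :* (A′ :* P′) := (A :* A′) :* (P :* P′))
                 refl (fromℤ a) (toℚ (p ^ r)) (fromℤ a′) (toℚ (p ^ s)) ⟩
    (fromℤ a *ℚ fromℤ a′) *ℚ (toℚ (p ^ r) *ℚ toℚ (p ^ s))
      ≡⟨ cong₂ _*ℚ_ (fromℤ-* a a′) (trans (cong toℚ (ℕ.^-distribˡ-+-* p r s)) (toℚ-* (p ^ r) (p ^ s))) ⟨
    fromℤ (a ℤ.* a′) *ℚ toℚ (p ^ (r + s)) ∎)
    where
    open ≡-Reasoning

  ≤ᵥ-weaken : ∀ {r s x} → s ≤ r → r ≤ᵥ x → s ≤ᵥ x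
  ≤ᵥ-weaken {r} {s} {x} s≤r (scaled a d p∤d eq) = scaled (a ℤ.* ℤ.+ (p ^ (r ∸ s))) d p∤d (begin
    x *ℚ toℚ d                                      ≡⟨ eq ⟩
    fromℤ a *ℚ toℚ (p ^ r)                          ≡⟨ cong (λ e → fromℤ a *ℚ toℚ (p ^ e)) (ℕ.m∸n+n≡m s≤r) ⟨
    fromℤ a *ℚ toℚ (p ^ (r ∸ s + s))
      ≡⟨ cong (fromℤ a *ℚ_) (trans (cong toℚ (ℕ.^-distribˡ-+-* p (r ∸ s) s)) (toℚ-* (p ^ (r ∸ s)) (p ^ s))) ⟩
    fromℤ a *ℚ (toℚ (p ^ (r ∸ s)) *ℚ toℚ (p ^ s))   ≡⟨ ℚ.*-assoc (fromℤ a) _ _ ⟨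
    fromℤ a *ℚ toℚ (p ^ (r ∸ s)) *ℚ toℚ (p ^ s)     ≡⟨ cong (_*ℚ toℚ (p ^ s)) (fromℤ-* a (ℤ.+ (p ^ (r ∸ s)))) ⟨
    fromℤ (a ℤ.* ℤ.+ (p ^ (r ∸ s))) *ℚ toℚ (p ^ s)  ∎)
    where
    open ≡-Reasoning

  ≤ᵥ-Σ : ∀ {r} n {f : ℕ → ℚ} → (∀ k → k < n → r ≤ᵥ f k) → r ≤ᵥ Σℚ n f
  ≤ᵥ-Σ {r} zero    _     = ≤ᵥ-0ℚ r
  ≤ᵥ-Σ     (suc n) r≤ᵥfk = ≤ᵥ-+ (≤ᵥ-Σ n (λ k k<n → r≤ᵥfk k (ℕ.m<n⇒m<1+n k<n))) (r≤ᵥfk n ℕ.≤-refl)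

  ≤ᵥ-cancel-p : ∀ {r x} → suc r ≤ᵥ (toℚ p *ℚ x) → r ≤ᵥ x
  ≤ᵥ-cancel-p {r} {x} (scaled a d p∤d eq) = scaled a d p∤d
    (*-cancelˡ-toℚ (p ∸ 1) (subst (λ q → toℚ q *ℚ (x *ℚ toℚ d) ≡ toℚ q *ℚ (fromℤ a *ℚ toℚ (p ^ r))) p≡1+[p∸1] (begin
      toℚ p *ℚ (x *ℚ toℚ d)                   ≡⟨ ℚ.*-assoc (toℚ p) x (toℚ d) ⟨
      (toℚ p *ℚ x) *ℚ toℚ d                   ≡⟨ eq ⟩
      fromℤ a *ℚ toℚ (p * p ^ r)              ≡⟨ cong (fromℤ a *ℚ_) (toℚ-* p (p ^ r)) ⟩
      fromℤ a *ℚ (toℚ p *ℚ toℚ (p ^ r))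
        ≡⟨ solve 3 (λ A P Q → A :* (P :* Q) := P :* (A :* Q)) refl (fromℤ a) (toℚ p) (toℚ (p ^ r)) ⟩
      toℚ p *ℚ (fromℤ a *ℚ toℚ (p ^ r))       ∎)))
    where
    open ≡-Reasoning

  0≤ᵥ-inv : ∀ {d} → ¬ p ∣ d → 0 ≤ᵥ inv d
  0≤ᵥ-inv {zero}  p∤0 = ⊥-elim (p∤0 (p ∣0))
  0≤ᵥ-inv {suc d} p∤d = scaled (ℤ.+ 1) (suc d) p∤d (trans (ℚ.*-comm (inv (suc d)) (toℚ (suc d))) (toℚ*inv≡1 d))

  1≤ᵥ-toℚ : ∀ {m} → p ∣ m → 1 ≤ᵥ toℚ m
  1≤ᵥ-toℚ (divides q refl) = subst (1 ≤ᵥ_) (trans (cong (toℚ q *ℚ_) (cong toℚ (ℕ.*-identityʳ p))) (sym (toℚ-* q p)))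
                                           (≤ᵥ-* (0≤ᵥ-toℚ q) (r≤ᵥp^r 1))

  p-power-split : ∀ {m} → 0 < m → ∃₂ λ e u → m ≡ p ^ e * u × ¬ p ∣ u
  p-power-split {m} = <-rec (λ m → 0 < m → ∃₂ λ e u → m ≡ p ^ e * u × ¬ p ∣ u) split m
    where
    split : ∀ m → (∀ {q} → q < m → 0 < q → ∃₂ λ e u → q ≡ p ^ e * u × ¬ p ∣ u) → 0 < m → ∃₂ λ e u → m ≡ p ^ e * u × ¬ p ∣ u
    split m rec 0<m with p ∣? m
    ... | no p∤m = 0 , m , sym (ℕ.+-identityʳ m) , p∤m
    ... | yes (divides zero    refl) = ⊥-elim (ℕ.<-irrefl refl 0<m)
    ... | yes (divides (suc q) refl) with rec (ℕ.m<m*n (suc q) p 1<p) (s≤s z≤n)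
    ...   | e , u , 1+q≡pᵉu , p∤u = suc e , u , trans (cong (_* p) 1+q≡pᵉu) (solve-pow (p ^ e) u) , p∤u
      where
      solve-pow : ∀ a b → a * b * p ≡ p * a * b
      solve-pow a b = trans (ℕ.*-comm (a * b) p) (sym (ℕ.*-assoc p a b))

  ≤ᵥ-p^j*inv : ∀ {r j m} → 0 < m → (∀ e → p ^ e ≤ m → r + e ≤ j) → r ≤ᵥ (toℚ (p ^ j) *ℚ inv m)
  ≤ᵥ-p^j*inv {r} {j} {m} 0<m bound with p-power-split 0<m
  ... | e , u , refl , p∤u = ≤ᵥ-weaken (ℕ.m+n≤o⇒m≤o∸n r r+e≤j) (scaled (ℤ.+ 1) u p∤u (begin
    toℚ (p ^ j) *ℚ inv m *ℚ toℚ u                              ≡⟨ cong (λ k → toℚ (p ^ k) *ℚ inv m *ℚ toℚ u) (ℕ.m∸n+n≡m e≤j) ⟨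
    toℚ (p ^ (j ∸ e + e)) *ℚ inv m *ℚ toℚ u
      ≡⟨ cong (λ z → z *ℚ inv m *ℚ toℚ u) (trans (cong toℚ (ℕ.^-distribˡ-+-* p (j ∸ e) e)) (toℚ-* (p ^ (j ∸ e)) (p ^ e))) ⟩
    toℚ (p ^ (j ∸ e)) *ℚ toℚ (p ^ e) *ℚ inv m *ℚ toℚ u
      ≡⟨ solve 4 (λ a b i c → a :* b :* i :* c := con 1ℚ :* a :* ((b :* c) :* i))
                 refl (toℚ (p ^ (j ∸ e))) (toℚ (p ^ e)) (inv m) (toℚ u) ⟩
    1ℚ *ℚ toℚ (p ^ (j ∸ e)) *ℚ ((toℚ (p ^ e) *ℚ toℚ u) *ℚ inv m)
      ≡⟨ cong (λ z → 1ℚ *ℚ toℚ (p ^ (j ∸ e)) *ℚ (z *ℚ inv m)) (toℚ-* (p ^ e) u) ⟨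
    1ℚ *ℚ toℚ (p ^ (j ∸ e)) *ℚ (toℚ m *ℚ inv m)                   ≡⟨ cong (1ℚ *ℚ toℚ (p ^ (j ∸ e)) *ℚ_) (m*inv≡1 0<m) ⟩
    1ℚ *ℚ toℚ (p ^ (j ∸ e)) *ℚ 1ℚ                                 ≡⟨ ℚ.*-identityʳ (1ℚ *ℚ toℚ (p ^ (j ∸ e))) ⟩
    fromℤ (ℤ.+ 1) *ℚ toℚ (p ^ (j ∸ e))                            ∎))
    where
    open ≡-Reasoning
    r+e≤j : r + e ≤ j
    r+e≤j = bound e (ℕ.m≤m*n (p ^ e) u {{ℕ.>-nonZero (p∤⇒0< p∤u)}})
    e≤j : e ≤ j
    e≤j = ℕ.m+n≤o⇒n≤o r r+e≤j
    m*inv≡1 : ∀ {k} → 0 < k → toℚ k *ℚ inv k ≡ 1ℚ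
    m*inv≡1 {suc k} _ = toℚ*inv≡1 k

  p^r∣m*d⇒p^r∣m : ∀ r {m d} → ¬ p ∣ d → p ^ r ∣ m * d → p ^ r ∣ m
  p^r∣m*d⇒p^r∣m zero    {m}     _   _ = 1∣ m
  p^r∣m*d⇒p^r∣m (suc r) {m} {d} p∤d p^[1+r]∣m*d with euclidsLemma m d p-prime (m*n∣⇒m∣ p (p ^ r) p^[1+r]∣m*d)
  ... | inj₂ p∣d = ⊥-elim (p∤d p∣d)
  ... | inj₁ (divides q refl) = subst (p * p ^ r ∣_) (ℕ.*-comm p q) (*-monoʳ-∣ p (p^r∣m*d⇒p^r∣m r p∤d p^r∣q*d))
    where
    p^r∣q*d : p ^ r ∣ q * d
    p^r∣q*d = *-cancelˡ-∣ p {{prime⇒nonZero p-prime}}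
      (subst (p * p ^ r ∣_) (trans (cong (_* d) (ℕ.*-comm q p)) (ℕ.*-assoc p q d)) p^[1+r]∣m*d)

  p∣↥x⇒p∤↧x : ∀ x → p ∣ ℤ.∣ ↥ x ∣ → ¬ p ∣ ↧ₙ x
  p∣↥x⇒p∤↧x (mkℚ _ _ coprime) p∣↥x p∣↧x = p∤1 (subst (p ∣_) (recompute coprime (p∣↥x , p∣↧x)) ∣-refl)

  ≤ᵥ⇒CongMod : ∀ {r x y} → r ≤ᵥ (x -ℚ y) → CongMod p r x y
  ≤ᵥ⇒CongMod {r} {x} {y} (scaled a d p∤d eq) = p^r∣N , p∤D
    where
    z = x -ℚ y
    N = ℤ.∣ ↥ z ∣
    D = ↧ₙ z
    N*d≡∣a∣*D*p^r : N * d ≡ ℤ.∣ a ∣ * D * p ^ r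
    N*d≡∣a∣*D*p^r = begin
      N * d                           ≡⟨ ∣↥x∣*d≡∣a∣*↧x z {d} {a ℤ.* ℤ.+ (p ^ r)} (trans eq (sym (fromℤ-* a (ℤ.+ (p ^ r))))) ⟩
      ℤ.∣ a ℤ.* ℤ.+ (p ^ r) ∣ * D     ≡⟨ cong (_* D) (ℤ.abs-* a (ℤ.+ (p ^ r))) ⟩
      ℤ.∣ a ∣ * p ^ r * D             ≡⟨ ℕ.*-assoc ℤ.∣ a ∣ (p ^ r) D ⟩
      ℤ.∣ a ∣ * (p ^ r * D)           ≡⟨ cong (ℤ.∣ a ∣ *_) (ℕ.*-comm (p ^ r) D) ⟩
      ℤ.∣ a ∣ * (D * p ^ r)           ≡⟨ ℕ.*-assoc ℤ.∣ a ∣ D (p ^ r) ⟨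
      ℤ.∣ a ∣ * D * p ^ r             ∎
      where
      open ≡-Reasoning
    p^r∣N : p ^ r ∣ N
    p^r∣N = p^r∣m*d⇒p^r∣m r p∤d (divides (ℤ.∣ a ∣ * D) N*d≡∣a∣*D*p^r)
    p∤D : ¬ p ∣ D
    p∤D p∣D with euclidsLemma N d p-prime (subst (p ∣_) (sym N*d≡∣a∣*D*p^r) (∣m⇒∣m*n (p ^ r) (∣n⇒∣m*n ℤ.∣ a ∣ p∣D)))
    ... | inj₂ p∣d = p∤d p∣d
    ... | inj₁ p∣N = p∣↥x⇒p∤↧x z p∣N p∣D

  ≤ᵥ-Σ-agree : ∀ {r k n} {f g : ℕ → ℚ} → k ≤ n → (∀ i → i < k → f i ≡ g i) →
               (∀ i → k ≤ i → i < n → r ≤ᵥ f i) → r ≤ᵥ Σℚ n f -ℚ Σℚ k g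
  ≤ᵥ-Σ-agree {r} {k} {n} {f} {g} k≤n f≡g r≤ᵥf = subst (r ≤ᵥ_) (sym difference) (≤ᵥ-Σ (n ∸ k) tail)
    where
    tail : ∀ i → i < n ∸ k → r ≤ᵥ f (k + i)
    tail i i<n∸k = r≤ᵥf (k + i) (ℕ.m≤m+n k i) (subst (k + i <_) (ℕ.m+[n∸m]≡n k≤n) (ℕ.+-monoʳ-< k i<n∸k))
    difference : Σℚ n f -ℚ Σℚ k g ≡ Σℚ (n ∸ k) (λ i → f (k + i))
    difference = begin
      Σℚ n f -ℚ Σℚ k g                                       ≡⟨ cong (_-ℚ Σℚ k g) (cong (λ l → Σℚ l f) (ℕ.m+[n∸m]≡n k≤n)) ⟨
      Σℚ (k + (n ∸ k)) f -ℚ Σℚ k g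
        ≡⟨ cong₂ _-ℚ_ (Σℚ-split k (n ∸ k) f) (Σℚ-cong k (λ i i<k → sym (f≡g i i<k))) ⟩
      (Σℚ k f +ℚ Σℚ (n ∸ k) (λ i → f (k + i))) -ℚ Σℚ k f
        ≡⟨ solve 2 (λ a b → (a :+ b) :- a := b) refl (Σℚ k f) (Σℚ (n ∸ k) (λ i → f (k + i))) ⟩
      Σℚ (n ∸ k) (λ i → f (k + i))                           ∎
      where
      open ≡-Reasoning

-- Power sums and Bernoulli numbers modulo p

powerSum-recurrence : ∀ m k → Σℚ (suc k) (λ j → toℚ (suc k C j) *ℚ powerSum m j) ≡ toℚ m ^ℚ suc k
powerSum-recurrence m k = begin
  Σℚ (suc k) (λ j → toℚ (suc k C j) *ℚ powerSum m j)
    ≡⟨ Σℚ-cong (suc k) (λ j _ → *-distribˡ-Σℚ m (toℚ (suc k C j)) _) ⟩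
  Σℚ (suc k) (λ j → Σℚ m (λ a → toℚ (suc k C j) *ℚ toℚ a ^ℚ j))  ≡⟨ Σℚ-swap m (suc k) _ ⟨
  Σℚ m (λ a → Σℚ (suc k) (λ j → toℚ (suc k C j) *ℚ toℚ a ^ℚ j))  ≡⟨ Σℚ-cong m (λ a _ → increment a) ⟩
  Σℚ m (λ a → toℚ (suc a) ^ℚ suc k -ℚ toℚ a ^ℚ suc k)            ≡⟨ Σℚ-telescope m (λ a → toℚ a ^ℚ suc k) ⟩
  toℚ m ^ℚ suc k -ℚ 0ℚ *ℚ 0ℚ ^ℚ k                               ≡⟨ cong (λ z → toℚ m ^ℚ suc k -ℚ z) (ℚ.*-zeroˡ (0ℚ ^ℚ k)) ⟩
  toℚ m ^ℚ suc k -ℚ 0ℚ                                           ≡⟨ solve 1 (λ x → x :- con 0ℚ := x) refl (toℚ m ^ℚ suc k) ⟩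
  toℚ m ^ℚ suc k                                                 ∎
  where
  open ≡-Reasoning
  increment : ∀ a → Σℚ (suc k) (λ j → toℚ (suc k C j) *ℚ toℚ a ^ℚ j) ≡ toℚ (suc a) ^ℚ suc k -ℚ toℚ a ^ℚ suc k
  increment a = begin
    s                                                  ≡⟨ solve 2 (λ s w → s := (s :+ con 1ℚ :* w) :- w) refl s (toℚ a ^ℚ suc k) ⟩
    (s +ℚ 1ℚ *ℚ toℚ a ^ℚ suc k) -ℚ toℚ a ^ℚ suc k
      ≡⟨ cong (λ c → (s +ℚ toℚ c *ℚ toℚ a ^ℚ suc k) -ℚ toℚ a ^ℚ suc k) (nCn≡1 (suc k)) ⟨
    Σℚ (suc (suc k)) (λ j → toℚ (suc k C j) *ℚ toℚ a ^ℚ j) -ℚ toℚ a ^ℚ suc k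
      ≡⟨ cong (_-ℚ toℚ a ^ℚ suc k) (binomial (toℚ a) (suc k)) ⟨
    (toℚ a +ℚ 1ℚ) ^ℚ suc k -ℚ toℚ a ^ℚ suc k           ≡⟨ cong (λ z → z ^ℚ suc k -ℚ toℚ a ^ℚ suc k) (toℚ-suc a) ⟨
    toℚ (suc a) ^ℚ suc k -ℚ toℚ a ^ℚ suc k             ∎
    where s = Σℚ (suc k) (λ j → toℚ (suc k C j) *ℚ toℚ a ^ℚ j)

binomial-middle : ∀ x q → (x +ℚ 1ℚ) ^ℚ suc q -ℚ (x +ℚ 1ℚ) ≡ Σℚ q (λ i → toℚ (suc q C suc i) *ℚ x ^ℚ suc i) +ℚ (x ^ℚ suc q -ℚ x)
binomial-middle x q = begin
  (x +ℚ 1ℚ) ^ℚ suc q -ℚ (x +ℚ 1ℚ)                    ≡⟨ cong (_-ℚ (x +ℚ 1ℚ)) (binomial x (suc q)) ⟩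
  (Σℚ (suc q) f +ℚ f (suc q)) -ℚ (x +ℚ 1ℚ)
    ≡⟨ cong₂ (λ s c → (s +ℚ toℚ c *ℚ x ^ℚ suc q) -ℚ (x +ℚ 1ℚ)) (Σℚ-first q f) (nCn≡1 (suc q)) ⟩
  ((1ℚ *ℚ 1ℚ +ℚ M) +ℚ 1ℚ *ℚ x ^ℚ suc q) -ℚ (x +ℚ 1ℚ)
    ≡⟨ solve 3 (λ m w x → ((con 1ℚ :* con 1ℚ :+ m) :+ con 1ℚ :* w) :- (x :+ con 1ℚ) := m :+ (w :- x)) refl M (x ^ℚ suc q) x ⟩
  M +ℚ (x ^ℚ suc q -ℚ x)                             ∎
  where
  open ≡-Reasoning
  f : ℕ → ℚ
  f i = toℚ (suc q C i) *ℚ x ^ℚ i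
  M = Σℚ q (λ i → f (suc i))

p∣pCi : ∀ {p i} → Prime p → 0 < i → i < p → p ∣ p C i
p∣pCi {suc q} {suc i} p-prime _ 1+i<p with euclidsLemma (suc i) (suc q C suc i) p-prime p∣[1+i]*pC[1+i]
  where
  p∣[1+i]*pC[1+i] : suc q ∣ suc i * (suc q C suc i)
  p∣[1+i]*pC[1+i] = divides (q C i) (trans ([k+1]*[n+1]C[k+1]≡[n+1]*nCk q i) (ℕ.*-comm (suc q) (q C i)))
... | inj₂ p∣pCi = p∣pCi
... | inj₁ p∣1+i = ⊥-elim (ℕ.<-irrefl refl (ℕ.<-≤-trans 1+i<p (∣⇒≤ p∣1+i)))

p*faulhaberTerm : ∀ p n ν → toℚ p *ℚ faulhaberTerm p n ν ≡ toℚ (n C ν) *ℚ ((toℚ p *ℚ B (n ∸ ν)) *ℚ (toℚ (p ^ ν) *ℚ inv (suc ν)))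
p*faulhaberTerm p n ν = solve 4 (λ P c b w → P :* (c :* (b :* w)) := c :* ((P :* b) :* w))
  refl (toℚ p) (toℚ (n C ν)) (B (n ∸ ν)) (toℚ (p ^ ν) *ℚ inv (suc ν))

module _ {p : ℕ} (p-prime : Prime p) where
  open Valuation p-prime

  p∤small : ∀ {i} → 0 < i → i < p → ¬ p ∣ i
  p∤small 0<i i<p p∣i = ℕ.<-irrefl refl (ℕ.<-≤-trans i<p (∣⇒≤ {{ℕ.>-nonZero 0<i}} p∣i))

  0≤ᵥ-toℚ-^ : ∀ a k → 0 ≤ᵥ toℚ a ^ℚ k
  0≤ᵥ-toℚ-^ a k = subst (0 ≤ᵥ_) (toℚ-^ a k) (0≤ᵥ-toℚ (a ^ k))

  1≤ᵥ-powerSum-below : ∀ k → suc k < p → 1 ≤ᵥ powerSum p k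
  1≤ᵥ-powerSum-below = <-rec (λ k → suc k < p → 1 ≤ᵥ powerSum p k) step
    where
    step : ∀ k → (∀ {j} → j < k → suc j < p → 1 ≤ᵥ powerSum p j) → suc k < p → 1 ≤ᵥ powerSum p k
    step k ih 1+k<p = subst (1 ≤ᵥ_) isolate (≤ᵥ-* (0≤ᵥ-inv (p∤small (s≤s z≤n) 1+k<p)) (≤ᵥ-sub p^[1+k] lower))
      where
      lower : 1 ≤ᵥ Σℚ k (λ j → toℚ (suc k C j) *ℚ powerSum p j)
      lower = ≤ᵥ-Σ k (λ j j<k → ≤ᵥ-* (0≤ᵥ-toℚ (suc k C j)) (ih j<k (ℕ.<-trans (s≤s j<k) 1+k<p)))
      p^[1+k] : 1 ≤ᵥ toℚ p ^ℚ suc k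
      p^[1+k] = subst (1 ≤ᵥ_) (toℚ-^ p (suc k)) (1≤ᵥ-toℚ (divides (p ^ k) (ℕ.*-comm p (p ^ k))))
      isolate : inv (suc k) *ℚ (toℚ p ^ℚ suc k -ℚ Σℚ k (λ j → toℚ (suc k C j) *ℚ powerSum p j)) ≡ powerSum p k
      isolate = begin
        inv (suc k) *ℚ (toℚ p ^ℚ suc k -ℚ R)
          ≡⟨ cong (λ z → inv (suc k) *ℚ (z -ℚ R)) (powerSum-recurrence p k) ⟨
        inv (suc k) *ℚ ((R +ℚ toℚ (suc k C k) *ℚ powerSum p k) -ℚ R)
          ≡⟨ cong (λ c → inv (suc k) *ℚ ((R +ℚ toℚ c *ℚ powerSum p k) -ℚ R)) ([n+1]Cn≡n+1 k) ⟩
        inv (suc k) *ℚ ((R +ℚ toℚ (suc k) *ℚ powerSum p k) -ℚ R)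
          ≡⟨ solve 4 (λ i r n t → i :* ((r :+ n :* t) :- r) := (n :* i) :* t) refl (inv (suc k)) R (toℚ (suc k)) (powerSum p k) ⟩
        (toℚ (suc k) *ℚ inv (suc k)) *ℚ powerSum p k               ≡⟨ cong (_*ℚ powerSum p k) (toℚ*inv≡1 k) ⟩
        1ℚ *ℚ powerSum p k                                         ≡⟨ ℚ.*-identityˡ (powerSum p k) ⟩
        powerSum p k                                               ∎
        where
        open ≡-Reasoning
        R = Σℚ k (λ j → toℚ (suc k C j) *ℚ powerSum p j)

  fermat : ∀ a → 1 ≤ᵥ toℚ a ^ℚ p -ℚ toℚ a
  fermat zero = subst (1 ≤ᵥ_) (sym 0^p-0≡0) (≤ᵥ-0ℚ 1)
    where
    0^p-0≡0 : 0ℚ ^ℚ p -ℚ 0ℚ ≡ 0ℚ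
    0^p-0≡0 = trans (cong (λ q → 0ℚ ^ℚ q -ℚ 0ℚ) p≡1+[p∸1]) (cong (_-ℚ 0ℚ) (ℚ.*-zeroˡ (0ℚ ^ℚ (p ∸ 1))))
  fermat (suc a) = subst (1 ≤ᵥ_) (sym expand) (≤ᵥ-+ middle (fermat a))
    where
    x = toℚ a
    middle : 1 ≤ᵥ Σℚ (p ∸ 1) (λ i → toℚ (p C suc i) *ℚ x ^ℚ suc i)
    middle = ≤ᵥ-Σ (p ∸ 1) (λ i i<p∸1 → subst (λ l → l ≤ᵥ toℚ (p C suc i) *ℚ x ^ℚ suc i) (ℕ.+-identityʳ 1)
               (≤ᵥ-* (1≤ᵥ-toℚ (p∣pCi p-prime (s≤s z≤n) (subst (suc i <_) (sym p≡1+[p∸1]) (s≤s i<p∸1))))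
                     (0≤ᵥ-toℚ-^ a (suc i))))
    expand : toℚ (suc a) ^ℚ p -ℚ toℚ (suc a) ≡ Σℚ (p ∸ 1) (λ i → toℚ (p C suc i) *ℚ x ^ℚ suc i) +ℚ (x ^ℚ p -ℚ x)
    expand = subst (λ q → toℚ (suc a) ^ℚ q -ℚ toℚ (suc a) ≡ Σℚ (q ∸ 1) (λ i → toℚ (q C suc i) *ℚ x ^ℚ suc i) +ℚ (x ^ℚ q -ℚ x))
               (sym p≡1+[p∸1]) (trans (cong (λ z → z ^ℚ suc (p ∸ 1) -ℚ z) (toℚ-suc a)) (binomial-middle x (p ∸ 1)))

  1≤ᵥ-powerSum-period : ∀ j → 1 ≤ j → 1 ≤ᵥ powerSum p (j + (p ∸ 1)) -ℚ powerSum p j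
  1≤ᵥ-powerSum-period (suc k) _ = subst (1 ≤ᵥ_) (sym Σ-difference)
    (≤ᵥ-Σ p (λ a _ → subst (1 ≤ᵥ_) (sym (factor a)) (≤ᵥ-* (0≤ᵥ-toℚ-^ a k) (fermat a))))
    where
    exponent : suc k + (p ∸ 1) ≡ k + p
    exponent = trans (sym (ℕ.+-suc k (p ∸ 1))) (cong (k +_) (sym p≡1+[p∸1]))
    factor : ∀ a → toℚ a ^ℚ (suc k + (p ∸ 1)) -ℚ toℚ a ^ℚ suc k ≡ toℚ a ^ℚ k *ℚ (toℚ a ^ℚ p -ℚ toℚ a)
    factor a = begin
      toℚ a ^ℚ (suc k + (p ∸ 1)) -ℚ toℚ a ^ℚ suc k          ≡⟨ cong (λ e → toℚ a ^ℚ e -ℚ toℚ a ^ℚ suc k) exponent ⟩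
      toℚ a ^ℚ (k + p) -ℚ toℚ a ^ℚ suc k                    ≡⟨ cong (_-ℚ toℚ a ^ℚ suc k) (^-homo-* (toℚ a) k p) ⟩
      toℚ a ^ℚ k *ℚ toℚ a ^ℚ p -ℚ toℚ a *ℚ toℚ a ^ℚ k
        ≡⟨ solve 3 (λ u w x → u :* w :- x :* u := u :* (w :- x)) refl (toℚ a ^ℚ k) (toℚ a ^ℚ p) (toℚ a) ⟩
      toℚ a ^ℚ k *ℚ (toℚ a ^ℚ p -ℚ toℚ a)                  ∎
      where
      open ≡-Reasoning
    Σ-difference : powerSum p (suc k + (p ∸ 1)) -ℚ powerSum p (suc k)
                 ≡ Σℚ p (λ a → toℚ a ^ℚ (suc k + (p ∸ 1)) -ℚ toℚ a ^ℚ suc k)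
    Σ-difference = sym (Σℚ-sub p _ _)

  1≤ᵥ-powerSum-periodic : ∀ j q → 1 ≤ j → 1 ≤ᵥ powerSum p (j + q * (p ∸ 1)) -ℚ powerSum p j
  1≤ᵥ-powerSum-periodic j zero    _   = subst (1 ≤ᵥ_)
    (sym (trans (cong (λ e → powerSum p e -ℚ powerSum p j) (ℕ.+-identityʳ j)) (ℚ.+-inverseʳ (powerSum p j)))) (≤ᵥ-0ℚ 1)
  1≤ᵥ-powerSum-periodic j (suc q) 1≤j = subst (1 ≤ᵥ_) telescoped
    (≤ᵥ-+ (1≤ᵥ-powerSum-period j′ (ℕ.≤-trans 1≤j (ℕ.m≤m+n j _))) (1≤ᵥ-powerSum-periodic j q 1≤j))
    where
    j′ = j + q * (p ∸ 1)
    telescoped : (powerSum p (j′ + (p ∸ 1)) -ℚ powerSum p j′) +ℚ (powerSum p j′ -ℚ powerSum p j)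
               ≡ powerSum p (j + suc q * (p ∸ 1)) -ℚ powerSum p j
    telescoped = trans
      (solve 3 (λ a b c → (a :- b) :+ (b :- c) := a :- c) refl (powerSum p (j′ + (p ∸ 1))) (powerSum p j′) (powerSum p j))
      (cong (λ e → powerSum p e -ℚ powerSum p j)
        (trans (ℕ.+-assoc j (q * (p ∸ 1)) (p ∸ 1)) (cong (j +_) (ℕ.+-comm (q * (p ∸ 1)) (p ∸ 1)))))

  instance
    p∸1≢0 : ℕ.NonZero (p ∸ 1)
    p∸1≢0 = ℕ.>-nonZero (ℕ.m<n⇒0<n∸m 1<p)

  1≤ᵥ-powerSum : ∀ {k} → ¬ (p ∸ 1) ∣ k → 1 ≤ᵥ powerSum p k
  1≤ᵥ-powerSum {k} p-1∤k with k ℕ.% (p ∸ 1) | ℕ.m%n<n k (p ∸ 1) | ℕ.m≡m%n+[m/n]*n k (p ∸ 1)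
  ... | zero  | _   | k≡[k/[p-1]]*[p-1] = ⊥-elim (p-1∤k (divides (k ℕ./ (p ∸ 1)) k≡[k/[p-1]]*[p-1]))
  ... | suc s | 1+s<p-1 | k≡[1+s]+[k/[p-1]]*[p-1] = subst (1 ≤ᵥ_) (cong (powerSum p) (sym k≡[1+s]+[k/[p-1]]*[p-1]))
    (subst (1 ≤ᵥ_) (solve 2 (λ a b → (a :- b) :+ b := a) refl (powerSum p (suc s + k ℕ./ (p ∸ 1) * (p ∸ 1))) (powerSum p (suc s)))
      (≤ᵥ-+ (1≤ᵥ-powerSum-periodic (suc s) (k ℕ./ (p ∸ 1)) (s≤s z≤n))
            (1≤ᵥ-powerSum-below (suc s) (subst (suc (suc (suc s)) ≤_) (sym p≡1+[p∸1]) (s≤s 1+s<p-1)))))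

  0≤ᵥ-powerSum : ∀ k → 0 ≤ᵥ powerSum p k
  0≤ᵥ-powerSum k = ≤ᵥ-Σ p (λ a _ → 0≤ᵥ-toℚ-^ a k)

  ≤ᵥ-p^ν*inv[1+ν] : ∀ {r ν} → 3 ≤ p → r + 2 ≤ p → r ≤ ν → r ≤ᵥ toℚ (p ^ ν) *ℚ inv (suc ν)
  ≤ᵥ-p^ν*inv[1+ν] 3≤p r+2≤p r≤ν = ≤ᵥ-p^j*inv (s≤s z≤n) (λ e pᵉ≤1+ν → r+e≤ν 3≤p e r+2≤p r≤ν pᵉ≤1+ν)

  1≤ᵥ-p*B-powerSum : 3 ≤ p → ∀ n → 1 ≤ᵥ toℚ p *ℚ B n -ℚ powerSum p n
  1≤ᵥ-p*B-powerSum 3≤p = <-rec (λ n → 1 ≤ᵥ toℚ p *ℚ B n -ℚ powerSum p n) step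
    where
    step : ∀ n → (∀ {m} → m < n → 1 ≤ᵥ toℚ p *ℚ B m -ℚ powerSum p m) → 1 ≤ᵥ toℚ p *ℚ B n -ℚ powerSum p n
    step n ih = subst (1 ≤ᵥ_) rearranged (≤ᵥ-neg (≤ᵥ-Σ n term))
      where
      pB : ∀ {m} → m < n → 0 ≤ᵥ toℚ p *ℚ B m
      pB {m} m<n = subst (0 ≤ᵥ_) (solve 2 (λ a t → (a :- t) :+ t := a) refl (toℚ p *ℚ B m) (powerSum p m))
                         (≤ᵥ-+ (≤ᵥ-weaken z≤n (ih m<n)) (0≤ᵥ-powerSum m))
      term : ∀ i → i < n → 1 ≤ᵥ toℚ p *ℚ faulhaberTerm p n (suc i)
      term i i<n = subst (1 ≤ᵥ_) (sym (p*faulhaberTerm p n (suc i)))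
        (≤ᵥ-* (0≤ᵥ-toℚ (n C suc i)) (≤ᵥ-* (pB (ℕ.∸-monoʳ-< (s≤s z≤n) i<n)) (≤ᵥ-p^ν*inv[1+ν] {1} {suc i} 3≤p 3≤p (s≤s z≤n))))
      rearranged : -ℚ Σℚ n (λ i → toℚ p *ℚ faulhaberTerm p n (suc i)) ≡ toℚ p *ℚ B n -ℚ powerSum p n
      rearranged = begin
        -ℚ Σℚ n (λ i → toℚ p *ℚ faulhaberTerm p n (suc i)) ≡⟨ cong -ℚ_ (*-distribˡ-Σℚ n (toℚ p) _) ⟨
        -ℚ (toℚ p *ℚ F)
          ≡⟨ solve 3 (λ P b f → :- (P :* f) := P :* b :- P :* (b :+ f)) refl (toℚ p) (B n) F ⟩
        toℚ p *ℚ B n -ℚ toℚ p *ℚ (B n +ℚ F)                 ≡⟨ cong (λ t → toℚ p *ℚ B n -ℚ t) (powerSum-expansion p n) ⟨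
        toℚ p *ℚ B n -ℚ powerSum p n                        ∎
        where
        open ≡-Reasoning
        F = Σℚ n (λ i → faulhaberTerm p n (suc i))

  0≤ᵥ-p*B : 3 ≤ p → ∀ n → 0 ≤ᵥ toℚ p *ℚ B n
  0≤ᵥ-p*B 3≤p n = subst (0 ≤ᵥ_) (solve 2 (λ a t → (a :- t) :+ t := a) refl (toℚ p *ℚ B n) (powerSum p n))
                        (≤ᵥ-+ (≤ᵥ-weaken z≤n (1≤ᵥ-p*B-powerSum 3≤p n)) (0≤ᵥ-powerSum n))

  0≤ᵥ-B : 3 ≤ p → ∀ {n} → ¬ (p ∸ 1) ∣ n → 0 ≤ᵥ B n
  0≤ᵥ-B 3≤p {n} p-1∤n = ≤ᵥ-cancel-p (subst (1 ≤ᵥ_) (solve 2 (λ a t → (a :- t) :+ t := a) refl (toℚ p *ℚ B n) (powerSum p n))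
                                             (≤ᵥ-+ (1≤ᵥ-p*B-powerSum 3≤p n) (1≤ᵥ-powerSum p-1∤n)))

-- The expansion of Ŝ_n(p)

Shat-expansion : ∀ {m n} → 1 ≤ m → 1 ≤ n →
  Shat n m ≡ (B n -ℚ toℚ (m ∸ 1) *ℚ inv m) +ℚ Σℚ n (λ ν → faulhaberTerm m n (suc ν))
Shat-expansion {suc m} {suc n} _ _ = begin
  (toℚ (S (suc n) (suc m)) -ℚ toℚ m) *ℚ inv (suc m)   ≡⟨ cong (λ z → (z -ℚ toℚ m) *ℚ inv (suc m)) S≡powerSum ⟩
  (powerSum (suc m) (suc n) -ℚ toℚ m) *ℚ inv (suc m)
    ≡⟨ cong (λ z → (z -ℚ toℚ m) *ℚ inv (suc m)) (powerSum-expansion (suc m) (suc n)) ⟩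
  (toℚ (suc m) *ℚ (B (suc n) +ℚ F) -ℚ toℚ m) *ℚ inv (suc m)
    ≡⟨ solve 5 (λ M b f a i → (M :* (b :+ f) :- a) :* i := (b :* (M :* i) :- a :* i) :+ f :* (M :* i))
               refl (toℚ (suc m)) (B (suc n)) F (toℚ m) (inv (suc m)) ⟩
  (B (suc n) *ℚ (toℚ (suc m) *ℚ inv (suc m)) -ℚ toℚ m *ℚ inv (suc m)) +ℚ F *ℚ (toℚ (suc m) *ℚ inv (suc m))
    ≡⟨ cong (λ u → (B (suc n) *ℚ u -ℚ toℚ m *ℚ inv (suc m)) +ℚ F *ℚ u) (toℚ*inv≡1 m) ⟩
  (B (suc n) *ℚ 1ℚ -ℚ toℚ m *ℚ inv (suc m)) +ℚ F *ℚ 1ℚ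
    ≡⟨ solve 3 (λ b a f → (b :* con 1ℚ :- a) :+ f :* con 1ℚ := (b :- a) :+ f) refl (B (suc n)) (toℚ m *ℚ inv (suc m)) F ⟩
  (B (suc n) -ℚ toℚ m *ℚ inv (suc m)) +ℚ F            ∎
  where
  open ≡-Reasoning
  F = Σℚ (suc n) (λ ν → faulhaberTerm (suc m) (suc n) (suc ν))
  S≡powerSum : toℚ (S (suc n) (suc m)) ≡ powerSum (suc m) (suc n)
  S≡powerSum = trans (toℚ-Σℕ (suc m) (_^ suc n)) (Σℚ-cong (suc m) (λ a _ → toℚ-^ a (suc n)))

Bt-multiple : ∀ {p m} → 1 ≤ m → (p ∸ 1) ∣ m → Bt p m ≡ B m +ℚ inv p -ℚ 1ℚ
Bt-multiple {p} {suc m} _ p-1∣m = if-cong (dec-true ((p ∸ 1) ∣? suc m) p-1∣m)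

Bt-nonmultiple : ∀ {p m} → 1 ≤ m → ¬ (p ∸ 1) ∣ m → Bt p m ≡ B m
Bt-nonmultiple {p} {suc m} _ p-1∤m = if-cong (dec-false ((p ∸ 1) ∣? suc m) p-1∤m)

correctionTerm : ℕ → ℕ → ℕ → ℚ
correctionTerm p n ν = if isEven ν ∧ does (2 ≤? ν) then toℚ (n C suc ν) *ℚ Bstar p (n ∸ ν) *ℚ toℚ (p ^ ν) else 0ℚ

correctionTerm-odd : ∀ {p n ν} → ¬ 2 ∣ ν → correctionTerm p n ν ≡ 0ℚ
correctionTerm-odd {ν = ν} 2∤ν = if-cong (cong (_∧ does (2 ≤? ν)) (dec-false (2 ∣? ν) 2∤ν))

correctionTerm-even : ∀ {p n ν} → 2 ∣ ν → 2 ≤ ν → correctionTerm p n ν ≡ toℚ (n C suc ν) *ℚ Bstar p (n ∸ ν) *ℚ toℚ (p ^ ν)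
correctionTerm-even {ν = ν} 2∣ν 2≤ν = if-cong (cong₂ _∧_ (dec-true (2 ∣? ν) 2∣ν) (dec-true (2 ≤? ν) 2≤ν))

Shat-difference : ∀ {p n r} → 1 ≤ p → 1 ≤ n → (p ∸ 1) ∣ n →
  Shat n p -ℚ (Bt p n +ℚ corrSum p n (suc r)) ≡
  Σℚ n (λ ν → faulhaberTerm p n (suc ν)) -ℚ Σℚ r (λ ν → correctionTerm p n (suc ν))
Shat-difference {suc p} {n} {r} 1≤p 1≤n p-1∣n = begin
  Shat n (suc p) -ℚ (Bt (suc p) n +ℚ corrSum (suc p) n (suc r))
    ≡⟨ cong₂ (λ s b → s -ℚ (b +ℚ corrSum (suc p) n (suc r))) (Shat-expansion 1≤p 1≤n) (Bt-multiple 1≤n p-1∣n) ⟩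
  ((B n -ℚ toℚ p *ℚ i) +ℚ F) -ℚ ((B n +ℚ i -ℚ 1ℚ) +ℚ corrSum (suc p) n (suc r))
    ≡⟨ cong (λ c → ((B n -ℚ toℚ p *ℚ i) +ℚ F) -ℚ ((B n +ℚ i -ℚ 1ℚ) +ℚ c))
            (trans (Σℚ-first r (correctionTerm (suc p) n)) (ℚ.+-identityˡ G)) ⟩
  ((B n -ℚ toℚ p *ℚ i) +ℚ F) -ℚ ((B n +ℚ i -ℚ 1ℚ) +ℚ G)
    ≡⟨ solve 6 (λ b P i f g one → ((b :- P :* i) :+ f) :- ((b :+ i :- one) :+ g) := (f :- g) :+ (one :- (P :+ con 1ℚ) :* i))
               refl (B n) (toℚ p) i F G 1ℚ ⟩
  (F -ℚ G) +ℚ (1ℚ -ℚ (toℚ p +ℚ 1ℚ) *ℚ i)  ≡⟨ cong (λ z → (F -ℚ G) +ℚ (1ℚ -ℚ z *ℚ i)) (toℚ-suc p) ⟨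
  (F -ℚ G) +ℚ (1ℚ -ℚ toℚ (suc p) *ℚ i)    ≡⟨ cong (λ z → (F -ℚ G) +ℚ (1ℚ -ℚ z)) (toℚ*inv≡1 p) ⟩
  (F -ℚ G) +ℚ (1ℚ -ℚ 1ℚ)                  ≡⟨ solve 2 (λ f g → (f :- g) :+ (con 1ℚ :- con 1ℚ) := f :- g) refl F G ⟩
  F -ℚ G                                   ∎
  where
  open ≡-Reasoning
  i = inv (suc p)
  F = Σℚ n (λ ν → faulhaberTerm (suc p) n (suc ν))
  G = Σℚ r (λ ν → correctionTerm (suc p) n (suc ν))

faulhaberTerm-odd : ∀ {p n ν} → 1 < n ∸ ν → ¬ 2 ∣ n ∸ ν → faulhaberTerm p n ν ≡ 0ℚ
faulhaberTerm-odd {p} {n} {ν} 1<n∸ν 2∤n∸ν = begin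
  toℚ (n C ν) *ℚ (B (n ∸ ν) *ℚ w)  ≡⟨ cong (λ b → toℚ (n C ν) *ℚ (b *ℚ w)) (B-odd 1<n∸ν 2∤n∸ν) ⟩
  toℚ (n C ν) *ℚ (0ℚ *ℚ w)         ≡⟨ solve 2 (λ c w → c :* (con 0ℚ :* w) := con 0ℚ) refl (toℚ (n C ν)) w ⟩
  0ℚ                               ∎
  where
  open ≡-Reasoning
  w = toℚ (p ^ ν) *ℚ inv (suc ν)

faulhaberTerm-via-next : ∀ {p n ν} → ν < n →
  faulhaberTerm p n ν ≡ toℚ (n C suc ν) *ℚ (B (n ∸ ν) *ℚ inv (n ∸ ν)) *ℚ toℚ (p ^ ν)
faulhaberTerm-via-next {p} {n} {ν} ν<n = begin
  toℚ (n C ν) *ℚ (B (n ∸ ν) *ℚ (P *ℚ inv (suc ν)))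
    ≡⟨ solve 4 (λ c b P i → c :* (b :* (P :* i)) := (c :* i) :* (b :* P)) refl (toℚ (n C ν)) (B (n ∸ ν)) P (inv (suc ν)) ⟩
  (toℚ (n C ν) *ℚ inv (suc ν)) *ℚ (B (n ∸ ν) *ℚ P)
    ≡⟨ cong (_*ℚ (B (n ∸ ν) *ℚ P)) (inv*toℚ≡toℚ*inv {ν} {n ∸ suc ν} {n C suc ν} {n C ν} absorb) ⟨
  (inv (suc (n ∸ suc ν)) *ℚ toℚ (n C suc ν)) *ℚ (B (n ∸ ν) *ℚ P)
    ≡⟨ cong (λ m → (inv m *ℚ toℚ (n C suc ν)) *ℚ (B (n ∸ ν) *ℚ P)) n∸ν≡1+[n∸[1+ν]] ⟨
  (inv (n ∸ ν) *ℚ toℚ (n C suc ν)) *ℚ (B (n ∸ ν) *ℚ P)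
    ≡⟨ solve 4 (λ i c b P → (i :* c) :* (b :* P) := c :* (b :* i) :* P) refl (inv (n ∸ ν)) (toℚ (n C suc ν)) (B (n ∸ ν)) P ⟩
  toℚ (n C suc ν) *ℚ (B (n ∸ ν) *ℚ inv (n ∸ ν)) *ℚ P          ∎
  where
  open ≡-Reasoning
  P = toℚ (p ^ ν)
  n∸ν≡1+[n∸[1+ν]] : n ∸ ν ≡ suc (n ∸ suc ν)
  n∸ν≡1+[n∸[1+ν]] = ℕ.+-∸-assoc 1 ν<n
  absorb : suc ν * (n C suc ν) ≡ suc (n ∸ suc ν) * (n C ν)
  absorb = trans ([k+1]*nC[k+1]≡[n∸k]*nCk n ν) (cong (_* (n C ν)) n∸ν≡1+[n∸[1+ν]])

faulhaberTerm≡correctionTerm : ∀ {p n ν} → 2 ∣ n → (p ∸ 1) ∣ n → p ∸ 1 ≤ n → 0 < ν → ν + 2 ≤ p ∸ 1 →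
                               faulhaberTerm p n ν ≡ correctionTerm p n ν
faulhaberTerm≡correctionTerm {p} {n} {ν} 2∣n p-1∣n p-1≤n 0<ν ν+2≤p-1 = by-parity (2 ∣? ν)
  where
  2+ν≤p-1 : suc (suc ν) ≤ p ∸ 1
  2+ν≤p-1 = subst (_≤ p ∸ 1) (ℕ.+-comm ν 2) ν+2≤p-1
  ν<n : ν < n
  ν<n = ℕ.≤-trans (ℕ.m≤n⇒m≤1+n ℕ.≤-refl) (ℕ.≤-trans 2+ν≤p-1 p-1≤n)
  ν≤n : ν ≤ n
  ν≤n = ℕ.<⇒≤ ν<n
  2≤n∸ν : 2 ≤ n ∸ ν
  2≤n∸ν = ℕ.m+n≤o⇒m≤o∸n 2 (ℕ.≤-trans 2+ν≤p-1 p-1≤n)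
  ∣n∸ν⇒∣ν : ∀ {m} → m ∣ n → m ∣ n ∸ ν → m ∣ ν
  ∣n∸ν⇒∣ν m∣n m∣n∸ν = ∣m+n∣m⇒∣n (subst (_ ∣_) (sym (ℕ.m∸n+n≡m ν≤n)) m∣n) m∣n∸ν
  p-1∤n∸ν : ¬ (p ∸ 1) ∣ n ∸ ν
  p-1∤n∸ν p-1∣n∸ν = ℕ.<-irrefl refl (ℕ.<-≤-trans (ℕ.<⇒≤ 2+ν≤p-1) (∣⇒≤ {{ℕ.>-nonZero 0<ν}} (∣n∸ν⇒∣ν p-1∣n p-1∣n∸ν)))
  by-parity : Dec (2 ∣ ν) → faulhaberTerm p n ν ≡ correctionTerm p n ν
  by-parity (no 2∤ν) = trans (faulhaberTerm-odd {p} {n} {ν} 2≤n∸ν (2∤ν ∘ ∣n∸ν⇒∣ν 2∣n)) (sym (correctionTerm-odd {p} {n} 2∤ν))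
  by-parity (yes 2∣ν) = sym (begin
    correctionTerm p n ν
      ≡⟨ correctionTerm-even {p} {n} 2∣ν (∣⇒≤ {{ℕ.>-nonZero 0<ν}} 2∣ν) ⟩
    toℚ (n C suc ν) *ℚ (Bt p (n ∸ ν) *ℚ inv (n ∸ ν)) *ℚ toℚ (p ^ ν)
      ≡⟨ cong (λ b → toℚ (n C suc ν) *ℚ (b *ℚ inv (n ∸ ν)) *ℚ toℚ (p ^ ν)) (Bt-nonmultiple {p} (ℕ.<⇒≤ 2≤n∸ν) p-1∤n∸ν) ⟩
    toℚ (n C suc ν) *ℚ (B (n ∸ ν) *ℚ inv (n ∸ ν)) *ℚ toℚ (p ^ ν)      ≡⟨ faulhaberTerm-via-next {p} ν<n ⟨
    faulhaberTerm p n ν                                               ∎)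
    where
    open ≡-Reasoning

m^[1+j]*inv[m]≡m^j : ∀ {m} j → 1 ≤ m → toℚ (m ^ suc j) *ℚ inv m ≡ toℚ (m ^ j)
m^[1+j]*inv[m]≡m^j {suc m} j _ = begin
  toℚ (suc m * suc m ^ j) *ℚ inv (suc m)          ≡⟨ cong (_*ℚ inv (suc m)) (toℚ-* (suc m) (suc m ^ j)) ⟩
  toℚ (suc m) *ℚ toℚ (suc m ^ j) *ℚ inv (suc m)
    ≡⟨ solve 3 (λ a b i → a :* b :* i := (a :* i) :* b) refl (toℚ (suc m)) (toℚ (suc m ^ j)) (inv (suc m)) ⟩
  (toℚ (suc m) *ℚ inv (suc m)) *ℚ toℚ (suc m ^ j) ≡⟨ cong (_*ℚ toℚ (suc m ^ j)) (toℚ*inv≡1 m) ⟩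
  1ℚ *ℚ toℚ (suc m ^ j)                           ≡⟨ ℚ.*-identityˡ (toℚ (suc m ^ j)) ⟩
  toℚ (suc m ^ j)                                 ∎
  where
  open ≡-Reasoning

faulhaberTerm-p-factored : ∀ p n ν →
  faulhaberTerm p n (suc ν) ≡ toℚ (n C suc ν) *ℚ ((toℚ p *ℚ B (n ∸ suc ν)) *ℚ (toℚ (p ^ ν) *ℚ inv (suc (suc ν))))
faulhaberTerm-p-factored p n ν =
  trans (cong (λ w → toℚ (n C suc ν) *ℚ (B (n ∸ suc ν) *ℚ (w *ℚ inv (suc (suc ν))))) (toℚ-* p (p ^ ν)))
  (solve 5 (λ c b P Q i → c :* (b :* ((P :* Q) :* i)) := c :* ((P :* b) :* (Q :* i))) refl
     (toℚ (n C suc ν)) (B (n ∸ suc ν)) (toℚ p) (toℚ (p ^ ν)) (inv (suc (suc ν))))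

module _ {p : ℕ} (p-prime : Prime p) (3≤p : 3 ≤ p) where
  open Valuation p-prime

  ≤ᵥ-faulhaberTerm-integral : ∀ {n r ν} → r + 2 ≤ p → r ≤ ν → 0 ≤ᵥ B (n ∸ ν) → r ≤ᵥ faulhaberTerm p n ν
  ≤ᵥ-faulhaberTerm-integral {n} {ν = ν} r+2≤p r≤ν 0≤ᵥB =
    ≤ᵥ-* (0≤ᵥ-toℚ (n C ν)) (≤ᵥ-* 0≤ᵥB (≤ᵥ-p^ν*inv[1+ν] p-prime 3≤p r+2≤p r≤ν))

  ≤ᵥ-faulhaberTerm-large : ∀ {n r ν} → r + 2 ≤ p → (p ∸ 1) + (p ∸ 1) ≤ suc ν → r ≤ᵥ faulhaberTerm p n (suc ν)
  ≤ᵥ-faulhaberTerm-large {n} {r} {ν} r+2≤p large = subst (r ≤ᵥ_) (sym (faulhaberTerm-p-factored p n ν))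
    (≤ᵥ-* (0≤ᵥ-toℚ (n C suc ν)) (≤ᵥ-* (0≤ᵥ-p*B p-prime 3≤p (n ∸ suc ν))
      (≤ᵥ-p^j*inv (s≤s z≤n) (λ e pᵉ≤2+ν → r+e≤ν-for-large-ν 3≤p e r+2≤p ([p∸1]+[p∸1]≤1+ν⇒p≤ν 3≤p large) pᵉ≤2+ν))))

  -- For ν = p − 1 the denominator ν + 1 = p costs a factor p, recovered from p ∣ C(n, ν) or else from δ = 0.
  ≤ᵥ-faulhaberTerm-at-p∸1 : ∀ {n r ν} → suc ν ≡ p → r + 2 ≤ p → (¬ p ∣ n C ν → r + 3 ≤ p) → r ≤ᵥ faulhaberTerm p n ν
  ≤ᵥ-faulhaberTerm-at-p∸1 {ν = zero} 1≡p with subst (3 ≤_) (sym 1≡p) 3≤p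
  ... | s≤s ()
  ≤ᵥ-faulhaberTerm-at-p∸1 {ν = suc zero} 2≡p with subst (3 ≤_) (sym 2≡p) 3≤p
  ... | s≤s (s≤s ())
  ≤ᵥ-faulhaberTerm-at-p∸1 {n} {r} {suc (suc j)} 3+j≡p r+2≤p δ-case =
    subst (r ≤ᵥ_) (sym factored) (by-divisibility (p ∣? n C suc (suc j)))
    where
    pB = toℚ p *ℚ B (n ∸ suc (suc j))
    factored : faulhaberTerm p n (suc (suc j)) ≡ toℚ (n C suc (suc j)) *ℚ (pB *ℚ toℚ (p ^ j))
    factored = trans (faulhaberTerm-p-factored p n (suc j))
      (cong (λ w → toℚ (n C suc (suc j)) *ℚ (pB *ℚ w))
            (trans (cong (λ m → toℚ (p ^ suc j) *ℚ inv m) 3+j≡p) (m^[1+j]*inv[m]≡m^j j (ℕ.≤-trans (s≤s z≤n) 3≤p))))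
    0≤ᵥpB : 0 ≤ᵥ pB
    0≤ᵥpB = 0≤ᵥ-p*B p-prime 3≤p (n ∸ suc (suc j))
    by-divisibility : Dec (p ∣ n C suc (suc j)) → r ≤ᵥ toℚ (n C suc (suc j)) *ℚ (pB *ℚ toℚ (p ^ j))
    by-divisibility (yes p∣C) = ≤ᵥ-weaken r≤1+j (≤ᵥ-* (1≤ᵥ-toℚ p∣C) (≤ᵥ-* 0≤ᵥpB (r≤ᵥp^r j)))
      where
      r≤1+j : r ≤ suc j
      r≤1+j = ℕ.+-cancelˡ-≤ 2 r (suc j) (subst (_≤ suc (suc (suc j))) (ℕ.+-comm r 2) (subst (r + 2 ≤_) (sym 3+j≡p) r+2≤p))
    by-divisibility (no p∤C)  = ≤ᵥ-weaken r≤j (≤ᵥ-* (0≤ᵥ-toℚ (n C suc (suc j))) (≤ᵥ-* 0≤ᵥpB (r≤ᵥp^r j)))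
      where
      r≤j : r ≤ j
      r≤j = ℕ.+-cancelˡ-≤ 3 r j (subst (_≤ suc (suc (suc j))) (ℕ.+-comm r 3) (subst (r + 3 ≤_) (sym 3+j≡p) (δ-case p∤C)))

  ≤ᵥ-faulhaberTerm : ∀ {n r ν} → (p ∸ 1) ∣ n → 1 ≤ r → r + 2 ≤ p → (p ∸ 1 < n → ¬ p ∣ n C (p ∸ 1) → r + 3 ≤ p) →
                     r ≤ ν → ν ≤ n → r ≤ᵥ faulhaberTerm p n ν
  ≤ᵥ-faulhaberTerm {ν = zero} _ 1≤r _ _ r≤0 _ = ⊥-elim (ℕ.<-irrefl refl (ℕ.≤-trans 1≤r r≤0))
  ≤ᵥ-faulhaberTerm {n} {r} {suc ν} p-1∣n _ r+2≤p δ-case r≤1+ν 1+ν≤n = by-cases (n ∸ suc ν ℕ.≟ 0) ((p ∸ 1) ∣? (n ∸ suc ν))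
    where
    by-cases : Dec (n ∸ suc ν ≡ 0) → Dec ((p ∸ 1) ∣ n ∸ suc ν) → r ≤ᵥ faulhaberTerm p n (suc ν)
    by-cases (yes n∸ν≡0) _ = ≤ᵥ-faulhaberTerm-integral {n} r+2≤p r≤1+ν (subst (λ m → 0 ≤ᵥ B m) (sym n∸ν≡0) (0≤ᵥ-toℚ 1))
    by-cases (no _) (no p-1∤n∸ν) = ≤ᵥ-faulhaberTerm-integral {n} r+2≤p r≤1+ν (0≤ᵥ-B p-prime 3≤p p-1∤n∸ν)
    by-cases (no n∸ν≢0) (yes p-1∣n∸ν) with m∣n⇒n≡m⊎m+m≤n (s≤s z≤n) p-1∣ν
      where p-1∣ν = ∣m+n∣m⇒∣n (subst ((p ∸ 1) ∣_) (sym (ℕ.m∸n+n≡m 1+ν≤n)) p-1∣n) p-1∣n∸ν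
    ... | inj₂ large = ≤ᵥ-faulhaberTerm-large {n} r+2≤p large
    ... | inj₁ 1+ν≡p-1 = ≤ᵥ-faulhaberTerm-at-p∸1 {n} (trans (cong suc 1+ν≡p-1) (sym p≡1+[p∸1])) r+2≤p
                           (λ p∤C → δ-case p-1<n (subst (λ k → ¬ p ∣ n C k) 1+ν≡p-1 p∤C))
      where
      p-1<n : p ∸ 1 < n
      p-1<n = subst (_< n) 1+ν≡p-1 (ℕ.≤∧≢⇒< 1+ν≤n (λ 1+ν≡n → n∸ν≢0 (trans (cong (n ∸_) 1+ν≡n) (ℕ.n∸n≡0 n))))

-- The role of δ

delta≤1 : ∀ d p → delta d p ≤ 1
delta≤1 d p with does (2 ≤? d) ∧ does (p ∣? (d ∸ 1))
... | true  = z≤n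
... | false = s≤s z≤n

delta≡0 : ∀ {d p} → 2 ≤ d → p ∣ d ∸ 1 → delta d p ≡ 0
delta≡0 {d} {p} 2≤d p∣d-1 = if-cong (cong₂ _∧_ (dec-true (2 ≤? d) 2≤d) (dec-true (p ∣? (d ∸ 1)) p∣d-1))

r+3∸delta≤p⇒r+2≤p : ∀ {r d p} → r + 3 ∸ delta d p ≤ p → r + 2 ≤ p
r+3∸delta≤p⇒r+2≤p {r} {d} {p} bound =
  ℕ.≤-trans (ℕ.≤-reflexive (sym (ℕ.+-∸-assoc r {3} {1} (s≤s z≤n)))) (ℕ.≤-trans (ℕ.∸-monoʳ-≤ (r + 3) (delta≤1 d p)) bound)

suc[d*[p∸1]]+[d∸1]≡d*p : ∀ d p → 1 ≤ d → 1 ≤ p → suc (d * (p ∸ 1)) + (d ∸ 1) ≡ d * p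
suc[d*[p∸1]]+[d∸1]≡d*p (suc d) (suc p) _ _ = trans (cong suc (ℕ.+-comm (suc d * p) d)) (sym (ℕ.*-suc (suc d) p))

-- p C(n + 1, p) = (n + 1) C(n, p − 1), and n + 1 + (d − 1) = d p.
¬p∣nC[p∸1]⇒p∣d∸1 : ∀ {p d} → Prime p → 1 ≤ d → ¬ p ∣ (d * (p ∸ 1)) C (p ∸ 1) → p ∣ d ∸ 1
¬p∣nC[p∸1]⇒p∣d∸1 {zero}  p-prime = ⊥-elim (¬prime[0] p-prime)
¬p∣nC[p∸1]⇒p∣d∸1 {suc p} {d} p-prime 1≤d p∤C with euclidsLemma (suc (d * p)) ((d * p) C p) p-prime
  (divides (suc (d * p) C suc p) (trans (sym ([k+1]*[n+1]C[k+1]≡[n+1]*nCk (d * p) p)) (ℕ.*-comm (suc p) _)))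
... | inj₂ p∣C   = ⊥-elim (p∤C p∣C)
... | inj₁ p∣1+n = ∣m+n∣m⇒∣n (subst (suc p ∣_) (sym (suc[d*[p∸1]]+[d∸1]≡d*p d (suc p) 1≤d (s≤s z≤n))) (n∣m*n d)) p∣1+n

¬p∣nC[p∸1]⇒r+3≤p : ∀ {p d r} → Prime p → 1 ≤ d → r + 3 ∸ delta d p ≤ p →
            p ∸ 1 < d * (p ∸ 1) → ¬ p ∣ (d * (p ∸ 1)) C (p ∸ 1) → r + 3 ≤ p
¬p∣nC[p∸1]⇒r+3≤p {p} {d} {r} p-prime 1≤d bound p-1<n p∤C =
  subst (λ δ → r + 3 ∸ δ ≤ p) (delta≡0 2≤d (¬p∣nC[p∸1]⇒p∣d∸1 p-prime 1≤d p∤C)) bound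
  where
  2≤d : 2 ≤ d
  2≤d = ℕ.≤∧≢⇒< 1≤d (λ 1≡d → ℕ.<-irrefl (sym (ℕ.*-identityˡ (p ∸ 1))) (subst (λ e → p ∸ 1 < e * (p ∸ 1)) (sym 1≡d) p-1<n))

2∣p∸1 : ∀ {p} → Prime p → 3 ≤ p → 2 ∣ p ∸ 1
2∣p∸1 {p} p-prime 3≤p with ¬2∣⇒odd {p} (λ 2∣p → Prime.notComposite p-prime (composite 3≤p 2∣p))
... | q , p≡1+q*2 = divides q (cong (_∸ 1) p≡1+q*2)

corollary3p4 : (p d r : ℕ) → Prime p → 5 ≤ p → 1 ≤ d → 1 ≤ r → r + 3 ∸ delta d p ≤ p →
    CongMod p r (Shat (d * (p ∸ 1)) p) (Bt p (d * (p ∸ 1)) +ℚ corrSum p (d * (p ∸ 1)) r)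
corollary3p4 p d (suc r-1) p-prime 5≤p 1≤d _ bound =
  ≤ᵥ⇒CongMod {x = Shat n p} {y = Bt p n +ℚ corrSum p n (suc r-1)}
    (subst (suc r-1 ≤ᵥ_) (sym (Shat-difference {p} {n} {r-1} 1≤p 1≤n p-1∣n)) (≤ᵥ-Σ-agree r-1≤n head tail))
  where
  open Valuation p-prime
  n : ℕ
  n = d * (p ∸ 1)
  3≤p : 3 ≤ p
  3≤p = ℕ.≤-trans (s≤s (s≤s (s≤s z≤n))) 5≤p
  1≤p : 1 ≤ p
  1≤p = ℕ.≤-trans (s≤s z≤n) 3≤p
  p-1∣n : (p ∸ 1) ∣ n
  p-1∣n = n∣m*n d
  p-1≤n : p ∸ 1 ≤ n
  p-1≤n = ℕ.m≤n*m (p ∸ 1) d {{ℕ.>-nonZero 1≤d}}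
  1≤n : 1 ≤ n
  1≤n = ℕ.≤-trans (ℕ.m+n≤o⇒m≤o∸n 1 (ℕ.≤-trans (s≤s (s≤s z≤n)) 3≤p)) p-1≤n
  r+2≤p : suc r-1 + 2 ≤ p
  r+2≤p = r+3∸delta≤p⇒r+2≤p {suc r-1} {d} bound
  r+1≤p-1 : r-1 + 2 ≤ p ∸ 1
  r+1≤p-1 = ℕ.m+n≤o⇒m≤o∸n (r-1 + 2) (subst (_≤ p) (ℕ.+-comm 1 (r-1 + 2)) r+2≤p)
  r-1≤n : r-1 ≤ n
  r-1≤n = ℕ.≤-trans (ℕ.m≤m+n r-1 2) (ℕ.≤-trans r+1≤p-1 p-1≤n)
  head : ∀ i → i < r-1 → faulhaberTerm p n (suc i) ≡ correctionTerm p n (suc i)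
  head i i<r-1 = faulhaberTerm≡correctionTerm (∣n⇒∣m*n d (2∣p∸1 p-prime 3≤p)) p-1∣n p-1≤n (s≤s z≤n)
                   (ℕ.≤-trans (ℕ.+-monoˡ-≤ 2 i<r-1) r+1≤p-1)
  tail : ∀ i → r-1 ≤ i → i < n → suc r-1 ≤ᵥ faulhaberTerm p n (suc i)
  tail i r-1≤i i<n = ≤ᵥ-faulhaberTerm p-prime 3≤p p-1∣n (s≤s z≤n) r+2≤p
                       (¬p∣nC[p∸1]⇒r+3≤p {p} {d} {suc r-1} p-prime 1≤d bound) (s≤s r-1≤i) i<n
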